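{- Let $X$ be a finite set with $|X|\ge3$, let $\mathfrak D\subseteq\mathfrak C^{\mathrm{full}}$ be non-empty and symmetric, and let $c\in\mathfrak C$. Then $c\in\mathrm{maj\text{ - }cl}(\mathfrak D)$ if and only if $\mathfrak D$ has a member which is not balanced or $c$ is pseudo-balanced.
   Context: $\mathfrak C$ is the set of partial choice functions on two-element subsets of $X$ ($c\{x,y\}\in\{x,y\}$ when defined), $\mathfrak C^{\mathrm{full}}$ those defined on all pairs. A permutation $\pi$ of $X$ acts by $\hat\pi(c)\{\pi(x),\pi(y)\}=\pi(c\{x,y\})$; symmetric means closed under this action. A full $d$ is balanced if $|\{y\ne x:d\{x,y\}=y\}|=(|X|-1)/2$ for every $x\in X$. $\mathrm{Tor}[c]$ is the directed graph on $X$ with edges $(x,y)$ where $c\{x,y\}=y$; $c$ is pseudo-balanced if every edge of $\mathrm{Tor}[c]$ lies on a directed cycle. $\bar t[d]=\langle t_{x,y}[d]:x\ne y\rangle$ with $t_{x,y}[d]=1$ if $d\{x,y\}=y$, $0$ if $d\{x,y\}=x$, $\tfrac12$ if undefined; $\mathrm{pr\text{ - }cl}(\mathfrak D)$ is the convex hull of $\{\bar t[d]:d\in\mathfrak D\}$; $\mathrm{maj}(\bar t)\{x,y\}=y\iff t_{x,y}>\tfrac12$ (undefined if $t_{x,y}=\tfrac12$); $\mathrm{maj\text{ - }cl}(\mathfrak D)=\{\mathrm{maj}(\bar t):\bar t\in\mathrm{pr\text{ - }cl}(\mathfrak D)\}$.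
   Formalization: The convex hull $\mathrm{pr\text{ - }cl}(\mathfrak D)$ used to define $\mathrm{maj\text{ - }cl}(\mathfrak D)$ is formed with nonnegative rational weights rather than real ones. -}

module Defs where

open import Data.Nat as ℕ using (ℕ; zero; suc)
open import Data.Fin using (Fin; _≟_)
open import Data.Fin.Permutation using (Permutation′; _⟨$⟩ʳ_; _⟨$⟩ˡ_)
open import Data.Maybe using (Maybe; just; nothing)
import Data.Maybe as Maybe
open import Data.Maybe.Properties using (≡-dec)
open import Data.List using (List; []; _∷_; allFin)
open import Data.List.Membership.Propositional using (_∈_)
open import Data.Rational as ℚ using (ℚ; 0ℚ; 1ℚ; ½; _≤_; _<_; _+_; _*_)
open import Data.Rational.Properties using (<-cmp)
open import Data.Product using (Σ; ∃; _×_; _,_; proj₁; proj₂)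
open import Data.Sum using (_⊎_)
open import Relation.Binary.PropositionalEquality using (_≡_; _≢_)
open import Relation.Binary.Construct.Closure.ReflexiveTransitive using (Star)
open import Relation.Binary.Definitions using (tri<; tri≈; tri>)
open import Relation.Nullary using (¬_; yes; no)

-- X = Fin n.  A (partial) choice function is represented by a map on ordered
-- pairs: c x y = just z  means c{x,y} = z, nothing means undefined.
-- Values on the diagonal (x = y) are irrelevant.
Choice : ℕ → Set
Choice n = Fin n → Fin n → Maybe (Fin n)

IsChoice : ∀ {n} → Choice n → Set
IsChoice {n} c = (x y : Fin n) → x ≢ y →
  (c x y ≡ c y x) × ((z : Fin n) → c x y ≡ just z → (z ≡ x ⊎ z ≡ y))

Full : ∀ {n} → Choice n → Set
Full {n} c = (x y : Fin n) → x ≢ y → ∃ λ z → c x y ≡ just z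

_≈_ : ∀ {n} → Choice n → Choice n → Set
_≈_ {n} c d = (x y : Fin n) → x ≢ y → c x y ≡ d x y

-- action of a permutation: π̂(c){π x, π y} = π (c{x,y})
act : ∀ {n} → Permutation′ n → Choice n → Choice n
act π c x′ y′ = Maybe.map (π ⟨$⟩ʳ_) (c (π ⟨$⟩ˡ x′) (π ⟨$⟩ˡ y′))

Symmetric : ∀ {n} → (Choice n → Set) → Set
Symmetric {n} D = (π : Permutation′ n) (d : Choice n) → D d → D (act π d)

wins : ∀ {n} → Choice n → Fin n → ℕ
wins {n} d x = go (allFin n)
  where
  go : List (Fin n) → ℕ
  go [] = 0
  go (y ∷ ys) with y ≟ x | ≡-dec _≟_ (d x y) (just y)
  ... | no _ | yes _ = suc (go ys)
  ... | _    | _     = go ys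

Balanced : ∀ {n} → Choice n → Set
Balanced {n} d = (x : Fin n) → 2 ℕ.* wins d x ≡ n ℕ.∸ 1

Edge : ∀ {n} → Choice n → Fin n → Fin n → Set
Edge c x y = (x ≢ y) × (c x y ≡ just y)

-- every edge (x,y) lies on a directed cycle, i.e. there is a directed
-- walk from y back to x in Tor[c]
PseudoBalanced : ∀ {n} → Choice n → Set
PseudoBalanced {n} c = (x y : Fin n) → Edge c x y → Star (Edge c) y x

t : ∀ {n} → Choice n → Fin n → Fin n → ℚ
t d x y with d x y
... | nothing = ½
... | just z with z ≟ y
...   | yes _ = 1ℚ
...   | no _  = 0ℚ

-- points of ℚ^{X×X} (diagonal ignored)
Point : ℕ → Set
Point n = Fin n → Fin n → ℚ

sumℚ : List ℚ → ℚ
sumℚ [] = 0ℚ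
sumℚ (q ∷ qs) = q + sumℚ qs

mapL : ∀ {A B : Set} → (A → B) → List A → List B
mapL f [] = []
mapL f (a ∷ as) = f a ∷ mapL f as

-- T lies in the convex hull pr-cl(D) of { t̄[d] : d ∈ D }:
-- T is a finite convex combination (rational weights) of such points
InPrCl : ∀ {n} → (Choice n → Set) → Point n → Set
InPrCl {n} D T =
  Σ (List (ℚ × Choice n)) λ ws →
    ((w : ℚ × Choice n) → w ∈ ws → (0ℚ ≤ proj₁ w) × D (proj₂ w))
    × (sumℚ (mapL proj₁ ws) ≡ 1ℚ)
    × ((x y : Fin n) → x ≢ y →
        T x y ≡ sumℚ (mapL (λ w → proj₁ w * t (proj₂ w) x y) ws))

maj : ∀ {n} → Point n → Choice n
maj T x y with <-cmp ½ (T x y)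
... | tri< _ _ _ = just y
... | tri≈ _ _ _ = nothing
... | tri> _ _ _ = just x

InMajCl : ∀ {n} → (Choice n → Set) → Choice n → Set
InMajCl {n} D c = Σ (Point n) λ T → InPrCl D T × (c ≈ maj T)

-- Write the points of pr-cl(D) near its centre as ½ + ε·v with ε > 0.  These feasible directions v
-- form a convex cone of skew flows which is invariant under permutations (D is symmetric) and
-- contains the centred vertex t̄[d] − ½ of every d ∈ D.  The images of a skew flow under the dihedral
-- group sum to zero, so the cone is a ℚ-linear subspace.  Alternating a tournament direction over the
-- permutations of three points gives a nonzero multiple of a triangle, hence every circulation is
-- feasible; if some d ∈ D is unbalanced, its divergence is not constant and u − (p q)·u yields an arc
-- modulo circulations, hence every skew flow is feasible.  Since maj(½ + ε·v) is the sign pattern of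
-- v, this gives c ∈ maj-cl(D) whenever some d is unbalanced, and, for pseudo-balanced c, by summing a
-- cycle through each edge of c.  Conversely, if every member of a convex combination is balanced, the
-- centred combination is a circulation; no net flow leaves the set of points reachable from y along
-- edges of c, so every edge (x, y) of c = maj(T) closes a cycle.

module Submission where

open import Defs
open import Data.Bool using (Bool; true; false; if_then_else_)
import Data.Bool.Properties as BoolP
open import Data.Empty using (⊥-elim)
open import Data.Fin using (Fin; zero; suc; toℕ; opposite; _≟_)
open import Data.Fin.Patterns using (0F; 1F; 2F)
import Data.Fin.Properties as FinP
open import Data.Fin.Permutation as Perm using (Permutation′; _⟨$⟩ʳ_; _⟨$⟩ˡ_; permutation; _∘ₚ_; transpose)
open import Data.List using (List; []; _∷_; _++_; allFin; tabulate)
open import Data.List.Membership.Propositional using (_∈_)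
open import Data.List.Membership.Propositional.Properties using (∈-++⁻)
open import Data.List.Relation.Unary.Any using (here; there)
open import Data.Maybe using (just; nothing)
import Data.Maybe as Maybe
open import Data.Maybe.Properties using (just-injective; ≡-dec)
open import Data.Nat as ℕ using (ℕ; zero; suc; _≤_; z≤n; s≤s; _%_)
import Data.Nat.Properties as ℕP
open import Data.Nat.DivMod using (_mod_; %-distribˡ-+; m%n%n≡m%n; [m+n]%n≡m%n; [m+kn]%n≡m%n; m<n⇒m%n≡m)
open import Data.Product using (∃; _×_; _,_; proj₁; proj₂; map₂)
open import Data.Rational as ℚ using (ℚ; 0ℚ; 1ℚ; ½; _+_; _*_; -_; _-_; 1/_; positive; nonNegative; ≢-nonZero)
import Data.Rational.Properties as ℚP
open import Data.Rational.Solver using (module +-*-Solver)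
open import Data.Sum using (_⊎_; inj₁; inj₂)
open import Function using (_∘_)
open import Function.Bundles using (_⇔_; mk⇔)
open import Relation.Binary.Construct.Closure.ReflexiveTransitive as Star using (Star; _◅_; _◅◅_)
open import Relation.Binary.Definitions using (tri<; tri≈; tri>)
open import Relation.Binary.PropositionalEquality using (_≡_; _≢_; refl; sym; trans; cong; cong₂; subst; module ≡-Reasoning)
open import Relation.Nullary using (¬_; Dec; yes; no; does)
open import Relation.Nullary.Decidable using (dec-true; dec-false; _×-dec_; ¬?)
open import Algebra.Properties.CommutativeMonoid.Sum ℚP.+-0-commutativeMonoid
  using (sum; sum-cong-≗; ∑-distrib-+; ∑-comm; sum-permute; sum-replicate-zero)
open import Algebra.Properties.CommutativeSemigroup ℕP.+-commutativeSemigroup using (x∙yz≈y∙xz)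
open import Algebra.Properties.Group ℚP.+-0-group using (∙-cancelˡ; ⁻¹-involutive)
open +-*-Solver using (solve; _:=_; _:+_; _:*_; :-_; _:-_; con)

private variable
  k n : ℕ

-- Finite sums and the Kronecker delta

sum-zero : ∀ k → sum {k} (λ _ → 0ℚ) ≡ 0ℚ
sum-zero = sum-replicate-zero

sum-neg : (f : Fin k → ℚ) → sum (λ i → - f i) ≡ - sum f
sum-neg {ℕ.zero} f = refl
sum-neg {ℕ.suc k} f = trans (cong (- f zero +_) (sum-neg (f ∘ suc))) (sym (ℚP.neg-distrib-+ (f zero) _))

sum-*ˡ : (c : ℚ) (f : Fin k → ℚ) → sum (λ i → c * f i) ≡ c * sum f
sum-*ˡ {ℕ.zero} c f = sym (ℚP.*-zeroʳ c)
sum-*ˡ {ℕ.suc k} c f = trans (cong (c * f zero +_) (sum-*ˡ c (f ∘ suc))) (sym (ℚP.*-distribˡ-+ c (f zero) _))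

sum-nonneg : (f : Fin k → ℚ) → (∀ i → 0ℚ ℚ.≤ f i) → 0ℚ ℚ.≤ sum f
sum-nonneg {ℕ.zero} f f≥0 = ℚP.≤-refl
sum-nonneg {ℕ.suc k} f f≥0 = ℚP.+-mono-≤ (f≥0 zero) (sum-nonneg (f ∘ suc) (f≥0 ∘ suc))

term≤sum : (f : Fin k → ℚ) → (∀ i → 0ℚ ℚ.≤ f i) → ∀ j → f j ℚ.≤ sum f
term≤sum f f≥0 zero = ℚP.≤-trans (ℚP.≤-reflexive (sym (ℚP.+-identityʳ (f zero))))
  (ℚP.+-monoʳ-≤ (f zero) (sum-nonneg (f ∘ suc) (f≥0 ∘ suc)))
term≤sum f f≥0 (suc j) = ℚP.≤-trans (term≤sum (f ∘ suc) (f≥0 ∘ suc) j)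
  (ℚP.≤-trans (ℚP.≤-reflexive (sym (ℚP.+-identityˡ _))) (ℚP.+-monoˡ-≤ _ (f≥0 zero)))

*-nonneg : ∀ {a b} → 0ℚ ℚ.≤ a → 0ℚ ℚ.≤ b → 0ℚ ℚ.≤ a * b
*-nonneg {a} {b} a≥0 b≥0 =
  ℚP.nonNegative⁻¹ _ {{ℚP.nonNeg*nonNeg⇒nonNeg a {{nonNegative a≥0}} b {{nonNegative b≥0}}}}

*-pos : ∀ {a b} → 0ℚ ℚ.< a → 0ℚ ℚ.< b → 0ℚ ℚ.< a * b
*-pos {a} {b} a>0 b>0 = ℚP.positive⁻¹ _ {{ℚP.pos*pos⇒pos a {{positive a>0}} b {{positive b>0}}}}

inverse : (q : ℚ) → q ≢ 0ℚ → ℚ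
inverse q q≢0 = (1/ q) {{≢-nonZero q≢0}}

inverse-*ˡ : (q : ℚ) (q≢0 : q ≢ 0ℚ) → inverse q q≢0 * q ≡ 1ℚ
inverse-*ˡ q q≢0 = ℚP.*-inverseˡ q {{≢-nonZero q≢0}}

inverse-cancelˡ : (q : ℚ) (q≢0 : q ≢ 0ℚ) (a : ℚ) → inverse q q≢0 * (q * a) ≡ a
inverse-cancelˡ q q≢0 a =
  trans (sym (ℚP.*-assoc (inverse q q≢0) q a)) (trans (cong (_* a) (inverse-*ˡ q q≢0)) (ℚP.*-identityˡ a))

pos⇒≢0 : ∀ {q} → 0ℚ ℚ.< q → q ≢ 0ℚ
pos⇒≢0 q>0 = ℚP.<⇒≢ q>0 ∘ sym

inverse-pos : ∀ {q} (q>0 : 0ℚ ℚ.< q) → 0ℚ ℚ.< inverse q (pos⇒≢0 q>0)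
inverse-pos {q} q>0 = ℚP.positive⁻¹ _ {{ℚP.1/pos⇒pos q {{positive q>0}}}}

ι : ℕ → ℚ
ι zero = 0ℚ
ι (suc k) = 1ℚ + ι k

ι-+ : ∀ a b → ι (a ℕ.+ b) ≡ ι a + ι b
ι-+ zero b = sym (ℚP.+-identityˡ (ι b))
ι-+ (suc a) b = trans (cong (1ℚ +_) (ι-+ a b)) (sym (ℚP.+-assoc 1ℚ (ι a) (ι b)))

ι-nonneg : ∀ a → 0ℚ ℚ.≤ ι a
ι-nonneg zero = ℚP.≤-refl
ι-nonneg (suc a) = ℚP.+-mono-≤ (ℚP.<⇒≤ (ℚP.positive⁻¹ 1ℚ)) (ι-nonneg a)

ι-pos : ∀ a → 0ℚ ℚ.< ι (suc a)
ι-pos a = ℚP.+-mono-<-≤ (ℚP.positive⁻¹ 1ℚ) (ι-nonneg a)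

ι-injective : ∀ {a b} → ι a ≡ ι b → a ≡ b
ι-injective {zero} {zero} _ = refl
ι-injective {zero} {suc b} 0≡ι = ⊥-elim (ℚP.<-irrefl 0≡ι (ι-pos b))
ι-injective {suc a} {zero} ι≡0 = ⊥-elim (ℚP.<-irrefl (sym ι≡0) (ι-pos a))
ι-injective {suc a} {suc b} ι≡ι = cong suc (ι-injective (∙-cancelˡ 1ℚ (ι a) (ι b) ι≡ι))

sum-ones : ∀ k → sum {k} (λ _ → 1ℚ) ≡ ι k
sum-ones zero = refl
sum-ones (suc k) = cong (1ℚ +_) (sum-ones k)

constant-sum-vanishes : ∀ m c → sum {suc m} (λ _ → c) ≡ 0ℚ → c ≡ 0ℚ
constant-sum-vanishes m c sum≡0 = begin
  c                              ≡⟨ inverse-cancelˡ N (pos⇒≢0 (ι-pos m)) c ⟨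
  N⁻¹ * (N * c)                  ≡⟨ cong (N⁻¹ *_) N*c≡0 ⟩
  N⁻¹ * 0ℚ                       ≡⟨ ℚP.*-zeroʳ N⁻¹ ⟩
  0ℚ                             ∎
  where
  open ≡-Reasoning
  N : ℚ
  N = ι (suc m)
  N⁻¹ : ℚ
  N⁻¹ = inverse N (pos⇒≢0 (ι-pos m))
  N*c≡0 : N * c ≡ 0ℚ
  N*c≡0 = begin
    N * c                          ≡⟨ cong (_* c) (sum-ones (suc m)) ⟨
    sum {suc m} (λ _ → 1ℚ) * c     ≡⟨ ℚP.*-comm (sum {suc m} (λ _ → 1ℚ)) c ⟩
    c * sum {suc m} (λ _ → 1ℚ)     ≡⟨ sum-*ˡ {suc m} c (λ _ → 1ℚ) ⟨
    sum {suc m} (λ _ → c * 1ℚ)     ≡⟨ sum-cong-≗ {suc m} (λ _ → ℚP.*-identityʳ c) ⟩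
    sum {suc m} (λ _ → c)          ≡⟨ sum≡0 ⟩
    0ℚ                             ∎

δ : Fin n → Fin n → ℚ
δ x a = if does (x ≟ a) then 1ℚ else 0ℚ

δ-diag : (x : Fin n) → δ x x ≡ 1ℚ
δ-diag x with x ≟ x
... | yes _ = refl
... | no x≢x = ⊥-elim (x≢x refl)

δ-≡ : {x a : Fin n} → x ≡ a → δ x a ≡ 1ℚ
δ-≡ {x = x} refl = δ-diag x

δ-≢ : {x a : Fin n} → x ≢ a → δ x a ≡ 0ℚ
δ-≢ {x = x} {a} x≢a with x ≟ a
... | yes x≡a = ⊥-elim (x≢a x≡a)
... | no _ = refl

δ-comm : (x a : Fin n) → δ x a ≡ δ a x
δ-comm x a with x ≟ a
... | yes x≡a = sym (δ-≡ (sym x≡a))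
... | no x≢a = sym (δ-≢ (x≢a ∘ sym))

δ-nonneg : (x a : Fin n) → 0ℚ ℚ.≤ δ x a
δ-nonneg x a with x ≟ a
... | yes _ = ℚP.<⇒≤ (ℚP.positive⁻¹ 1ℚ)
... | no _ = ℚP.≤-refl

δ-perm : (π : Permutation′ n) (x a : Fin n) → δ (π ⟨$⟩ˡ x) a ≡ δ x (π ⟨$⟩ʳ a)
δ-perm π x a with x ≟ π ⟨$⟩ʳ a
... | yes refl = δ-≡ (Perm.inverseˡ π)
... | no x≢πa = δ-≢ (λ π⁻¹x≡a → x≢πa (trans (sym (Perm.inverseʳ π)) (cong (π ⟨$⟩ʳ_) π⁻¹x≡a)))

sum-*δ : (f : Fin n → ℚ) (b : Fin n) → sum (λ y → f y * δ y b) ≡ f b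
sum-*δ {ℕ.suc n} f zero = trans (cong₂ _+_ (ℚP.*-identityʳ (f zero))
  (trans (sum-cong-≗ (λ i → ℚP.*-zeroʳ (f (suc i)))) (sum-zero n))) (ℚP.+-identityʳ (f zero))
sum-*δ f (suc b) = trans (cong₂ _+_ (ℚP.*-zeroʳ (f zero)) (sum-*δ (f ∘ suc) b)) (ℚP.+-identityˡ _)

sum-*δ′ : (f : Fin n → ℚ) (b : Fin n) → sum (λ y → f y * δ b y) ≡ f b
sum-*δ′ f b = trans (sum-cong-≗ (λ y → cong (f y *_) (δ-comm b y))) (sum-*δ f b)

sum-δ : (b : Fin n) → sum (λ y → δ y b) ≡ 1ℚ
sum-δ b = trans (sum-cong-≗ (λ y → sym (ℚP.*-identityˡ (δ y b)))) (sum-*δ (λ _ → 1ℚ) b)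

δδ-≢ : {a a′ b b′ : Fin n} → ¬ (a ≡ a′ × b ≡ b′) → δ a a′ * δ b b′ ≡ 0ℚ
δδ-≢ {a = a} {a′} {b} {b′} ¬both = by-cases (a ≟ a′) (b ≟ b′)
  where
  by-cases : Dec (a ≡ a′) → Dec (b ≡ b′) → δ a a′ * δ b b′ ≡ 0ℚ
  by-cases (yes a≡a′) (yes b≡b′) = ⊥-elim (¬both (a≡a′ , b≡b′))
  by-cases (no a≢a′) _ = trans (cong (_* δ b b′) (δ-≢ a≢a′)) (ℚP.*-zeroˡ (δ b b′))
  by-cases (yes _) (no b≢b′) = trans (cong (δ a a′ *_) (δ-≢ b≢b′)) (ℚP.*-zeroʳ (δ a a′))

-- Flows

Flow : ℕ → Set
Flow n = Fin n → Fin n → ℚ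

infix 4 _≐_
infixl 6 _⊕_
infixr 7 _⊛_
infixr 8 _·_

_≐_ : Flow n → Flow n → Set
v ≐ w = ∀ x y → x ≢ y → v x y ≡ w x y

_⊕_ : Flow n → Flow n → Flow n
(v ⊕ w) x y = v x y + w x y

_⊛_ : ℚ → Flow n → Flow n
(q ⊛ v) x y = q * v x y

⊖_ : Flow n → Flow n
(⊖ v) x y = - v x y

𝟎 : Flow n
𝟎 x y = 0ℚ

_·_ : Permutation′ n → Flow n → Flow n
(π · v) x y = v (π ⟨$⟩ˡ x) (π ⟨$⟩ˡ y)

⨁ : (Fin k → Flow n) → Flow n
⨁ g x y = sum (λ i → g i x y)

Skew : Flow n → Set
Skew v = ∀ x y → v y x ≡ - v x y

Circulation : Flow n → Set
Circulation v = Skew v × (∀ x → sum (v x) ≡ 0ℚ)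

Complementary : Flow n → Set
Complementary T = ∀ x y → x ≢ y → T x y + T y x ≡ 1ℚ

-- The factor 1 − δ x y clears the diagonal, where a point T carries no information.
centred : Flow n → Flow n
centred T x y = (1ℚ - δ x y) * (T x y - ½)

centred-≐ : (T : Flow n) → centred T ≐ (λ x y → T x y - ½)
centred-≐ T x y x≢y = trans (cong (λ e → (1ℚ - e) * (T x y - ½)) (δ-≢ x≢y)) (ℚP.*-identityˡ _)

centred-diagonal : (T : Flow n) (x : Fin n) → centred T x x ≡ 0ℚ
centred-diagonal T x = trans (cong (λ e → (1ℚ - e) * (T x x - ½)) (δ-diag x)) (ℚP.*-zeroˡ (T x x - ½))

centred-skew : {T : Flow n} → Complementary T → Skew (centred T)
centred-skew {T = T} T-compl x y = by-cases (x ≟ y)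
  where
  open ≡-Reasoning
  flip-about-½ : ∀ a b → a + b ≡ 1ℚ → b - ½ ≡ - (a - ½)
  flip-about-½ a b a+b≡1 = trans (solve 2 (λ a b → b :- con ½ := (:- (a :- con ½)) :+ ((a :+ b) :- con 1ℚ)) refl a b)
    (trans (cong (λ s → - (a - ½) + (s - 1ℚ)) a+b≡1) (ℚP.+-identityʳ _))
  by-cases : Dec (x ≡ y) → centred T y x ≡ - centred T x y
  by-cases (yes refl) = trans (centred-diagonal T x) (sym (cong -_ (centred-diagonal T x)))
  by-cases (no x≢y) = begin
    centred T y x         ≡⟨ centred-≐ T y x (x≢y ∘ sym) ⟩
    T y x - ½             ≡⟨ flip-about-½ (T x y) (T y x) (T-compl x y x≢y) ⟩
    - (T x y - ½)         ≡⟨ cong -_ (sym (centred-≐ T x y x≢y)) ⟩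
    - centred T x y       ∎

ΣΣ : (Fin n → Fin n → ℚ) → ℚ
ΣΣ h = sum (λ a → sum (h a))

ΣΣ-cong : {g h : Fin n → Fin n → ℚ} → (∀ a b → g a b ≡ h a b) → ΣΣ g ≡ ΣΣ h
ΣΣ-cong g≡h = sum-cong-≗ (λ a → sum-cong-≗ (g≡h a))

ΣΣ-+ : (g h : Fin n → Fin n → ℚ) → ΣΣ (λ a b → g a b + h a b) ≡ ΣΣ g + ΣΣ h
ΣΣ-+ g h = trans (sum-cong-≗ (λ a → ∑-distrib-+ (g a) (h a))) (∑-distrib-+ (λ a → sum (g a)) (λ a → sum (h a)))

ΣΣ-*ˡ : (c : ℚ) (h : Fin n → Fin n → ℚ) → ΣΣ (λ a b → c * h a b) ≡ c * ΣΣ h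
ΣΣ-*ˡ c h = trans (sum-cong-≗ (λ a → sum-*ˡ c (h a))) (sum-*ˡ c (λ a → sum (h a)))

ΣΣ-δδ : (h : Fin n → Fin n → ℚ) (x y : Fin n) → ΣΣ (λ a b → h a b * (δ x a * δ y b)) ≡ h x y
ΣΣ-δδ h x y = begin
  ΣΣ (λ a b → h a b * (δ x a * δ y b))        ≡⟨ ΣΣ-cong (λ a b → regroup (h a b) (δ x a) (δ y b)) ⟩
  sum (λ a → sum (λ b → (h a b * δ x a) * δ y b)) ≡⟨ sum-cong-≗ (λ a → sum-*δ′ (λ b → h a b * δ x a) y) ⟩
  sum (λ a → h a y * δ x a)                   ≡⟨ sum-*δ′ (λ a → h a y) x ⟩
  h x y                                       ∎
  where
  open ≡-Reasoning
  regroup : ∀ p q r → p * (q * r) ≡ (p * q) * r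
  regroup p q r = sym (ℚP.*-assoc p q r)

ΣΣ-row-weighted : {v : Flow n} → (∀ a → sum (v a) ≡ 0ℚ) → (f : Fin n → ℚ) → ΣΣ (λ a b → v a b * f a) ≡ 0ℚ
ΣΣ-row-weighted {n} {v} rows f = begin
  sum (λ a → sum (λ b → v a b * f a))   ≡⟨ sum-cong-≗ (λ a → trans (sum-cong-≗ (λ b → ℚP.*-comm (v a b) (f a))) (sum-*ˡ (f a) (v a))) ⟩
  sum (λ a → f a * sum (v a))           ≡⟨ sum-cong-≗ (λ a → trans (cong (f a *_) (rows a)) (ℚP.*-zeroʳ (f a))) ⟩
  sum {n} (λ _ → 0ℚ)                    ≡⟨ sum-zero n ⟩
  0ℚ                                    ∎
  where open ≡-Reasoning

ΣΣ-skew : {v : Flow n} → Skew v → ΣΣ v ≡ 0ℚ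
ΣΣ-skew {v = v} v-skew = begin
  S               ≡⟨ solve 1 (λ s → s := con ½ :* (s :+ s)) refl S ⟩
  ½ * (S + S)     ≡⟨ cong (λ r → ½ * (S + r)) S≡-S ⟩
  ½ * (S + - S)   ≡⟨ cong (½ *_) (ℚP.+-inverseʳ S) ⟩
  ½ * 0ℚ          ≡⟨ ℚP.*-zeroʳ ½ ⟩
  0ℚ              ∎
  where
  open ≡-Reasoning
  S = ΣΣ v
  S≡-S : S ≡ - S
  S≡-S = trans (∑-comm v) (trans (sum-cong-≗ (λ b → trans (sum-cong-≗ (λ a → v-skew b a)) (sum-neg (v b))))
                                 (sum-neg (λ b → sum (v b))))

ΣΣ-positive : (h : Fin n → Fin n → ℚ) → (∀ a b → 0ℚ ℚ.≤ h a b) → ∀ a₀ b₀ → 0ℚ ℚ.< h a₀ b₀ → 0ℚ ℚ.< ΣΣ h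
ΣΣ-positive h h≥0 a₀ b₀ h>0 = begin-strict
  0ℚ           <⟨ h>0 ⟩
  h a₀ b₀      ≤⟨ term≤sum (h a₀) (h≥0 a₀) b₀ ⟩
  sum (h a₀)   ≤⟨ term≤sum (λ a → sum (h a)) (λ a → sum-nonneg (h a) (h≥0 a)) a₀ ⟩
  ΣΣ h         ∎
  where open ℚP.≤-Reasoning

arc : Fin n → Fin n → Flow n
arc a b x y = δ x a * δ y b - δ x b * δ y a

triangle : Fin n → Fin n → Fin n → Flow n
triangle a b c = arc a b ⊕ arc b c ⊕ arc c a

arc-skew : (a b : Fin n) → Skew (arc a b)
arc-skew a b x y = solve 4 (λ p q r s → p :* q :- r :* s := :- (s :* r :- q :* p)) refl (δ y a) (δ x b) (δ y b) (δ x a)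

arc-act : (π : Permutation′ n) (a b : Fin n) → π · arc a b ≐ arc (π ⟨$⟩ʳ a) (π ⟨$⟩ʳ b)
arc-act π a b x y _ = cong₂ _-_ (cong₂ _*_ (δ-perm π x a) (δ-perm π y b)) (cong₂ _*_ (δ-perm π x b) (δ-perm π y a))

triangle-act : (π : Permutation′ n) (a b c : Fin n) →
               π · triangle a b c ≐ triangle (π ⟨$⟩ʳ a) (π ⟨$⟩ʳ b) (π ⟨$⟩ʳ c)
triangle-act π a b c x y x≢y =
  cong₂ _+_ (cong₂ _+_ (arc-act π a b x y x≢y) (arc-act π b c x y x≢y)) (arc-act π c a x y x≢y)

arc-divergence : (a b x : Fin n) → sum (arc a b x) ≡ δ x a - δ x b
arc-divergence {n} a b x = begin
  sum (λ y → δ x a * δ y b - δ x b * δ y a)           ≡⟨ ∑-distrib-+ (λ y → δ x a * δ y b) (λ y → - (δ x b * δ y a)) ⟩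
  sum (λ y → δ x a * δ y b) + sum (λ y → - (δ x b * δ y a))
    ≡⟨ cong₂ _+_ (sum-*ˡ (δ x a) (λ y → δ y b)) (trans (sum-neg (λ y → δ x b * δ y a)) (cong -_ (sum-*ˡ (δ x b) (λ y → δ y a)))) ⟩
  δ x a * sum (λ y → δ y b) - δ x b * sum (λ y → δ y a) ≡⟨ cong₂ (λ p q → δ x a * p - δ x b * q) (sum-δ b) (sum-δ a) ⟩
  δ x a * 1ℚ - δ x b * 1ℚ                             ≡⟨ cong₂ _-_ (ℚP.*-identityʳ (δ x a)) (ℚP.*-identityʳ (δ x b)) ⟩
  δ x a - δ x b                                       ∎
  where open ≡-Reasoning

circulation-columns : {v : Flow n} → Circulation v → ∀ b → sum (λ a → v a b) ≡ 0ℚ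
circulation-columns {v = v} (v-skew , rows) b =
  trans (sum-cong-≗ (λ a → v-skew b a)) (trans (sum-neg (v b)) (cong -_ (rows b)))

skew-decomposition : {v : Flow n} → Skew v → ∀ x y → ΣΣ (λ a b → (½ * v a b) * arc a b x y) ≡ v x y
skew-decomposition {n} {v} v-skew x y = begin
  ΣΣ (λ a b → (½ * v a b) * arc a b x y)
    ≡⟨ ΣΣ-cong (λ a b → expand (v a b) (δ x a) (δ y b) (δ x b) (δ y a)) ⟩
  ΣΣ (λ a b → ½ * forward a b + - ½ * backward a b)
    ≡⟨ ΣΣ-+ (λ a b → ½ * forward a b) (λ a b → - ½ * backward a b) ⟩
  ΣΣ (λ a b → ½ * forward a b) + ΣΣ (λ a b → - ½ * backward a b)
    ≡⟨ cong₂ _+_ (ΣΣ-*ˡ ½ forward) (ΣΣ-*ˡ (- ½) backward) ⟩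
  ½ * ΣΣ forward + - ½ * ΣΣ backward
    ≡⟨ cong₂ (λ p q → ½ * p + - ½ * q) (ΣΣ-δδ v x y) (ΣΣ-δδ v y x) ⟩
  ½ * v x y + - ½ * v y x
    ≡⟨ cong (λ q → ½ * v x y + - ½ * q) (v-skew x y) ⟩
  ½ * v x y + - ½ * - v x y
    ≡⟨ halves (v x y) ⟩
  v x y ∎
  where
  open ≡-Reasoning
  forward backward : Fin n → Fin n → ℚ
  forward a b = v a b * (δ x a * δ y b)
  backward a b = v a b * (δ y a * δ x b)
  expand : ∀ h p q r s → (½ * h) * (p * q - r * s) ≡ ½ * (h * (p * q)) + - ½ * (h * (s * r))
  expand = solve 5 (λ h p q r s → (con ½ :* h) :* (p :* q :- r :* s)
                                  := con ½ :* (h :* (p :* q)) :+ (:- con ½) :* (h :* (s :* r))) refl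
  halves : ∀ a → ½ * a + - ½ * - a ≡ a
  halves = solve 1 (λ a → con ½ :* a :+ (:- con ½) :* (:- a) := a) refl

circulation-decomposition : {v : Flow n} → Circulation v → ∀ x₀ x y →
                            ΣΣ (λ a b → (½ * v a b) * triangle x₀ a b x y) ≡ v x y
circulation-decomposition {v = v} v-circ@(v-skew , rows) x₀ x y = begin
  ΣΣ (λ a b → (½ * v a b) * triangle x₀ a b x y)
    ≡⟨ ΣΣ-cong (λ a b → expand (v a b) (arc a b x y) (arc x₀ a x y) (arc b x₀ x y)) ⟩
  ΣΣ (λ a b → (½ * v a b) * arc a b x y + (½ * (v a b * arc x₀ a x y) + ½ * (v a b * arc b x₀ x y)))
    ≡⟨ ΣΣ-+ (λ a b → (½ * v a b) * arc a b x y) (λ a b → ½ * (v a b * arc x₀ a x y) + ½ * (v a b * arc b x₀ x y)) ⟩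
  ΣΣ (λ a b → (½ * v a b) * arc a b x y) + ΣΣ (λ a b → ½ * (v a b * arc x₀ a x y) + ½ * (v a b * arc b x₀ x y))
    ≡⟨ cong₂ _+_ (skew-decomposition v-skew x y)
                 (trans (ΣΣ-+ (λ a b → ½ * (v a b * arc x₀ a x y)) (λ a b → ½ * (v a b * arc b x₀ x y)))
                        (cong₂ _+_ through-rows through-columns)) ⟩
  v x y + (0ℚ + 0ℚ)
    ≡⟨ ℚP.+-identityʳ (v x y) ⟩
  v x y ∎
  where
  open ≡-Reasoning
  expand : ∀ h p q r → (½ * h) * (q + p + r) ≡ (½ * h) * p + (½ * (h * q) + ½ * (h * r))
  expand = solve 4 (λ h p q r → (con ½ :* h) :* (q :+ p :+ r) := (con ½ :* h) :* p :+ (con ½ :* (h :* q) :+ con ½ :* (h :* r))) refl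
  through-rows : ΣΣ (λ a b → ½ * (v a b * arc x₀ a x y)) ≡ 0ℚ
  through-rows = trans (ΣΣ-*ˡ ½ (λ a b → v a b * arc x₀ a x y))
    (trans (cong (½ *_) (ΣΣ-row-weighted rows (λ a → arc x₀ a x y))) (ℚP.*-zeroʳ ½))
  through-columns : ΣΣ (λ a b → ½ * (v a b * arc b x₀ x y)) ≡ 0ℚ
  through-columns = trans (ΣΣ-*ˡ ½ (λ a b → v a b * arc b x₀ x y)) (trans (cong (½ *_) columns) (ℚP.*-zeroʳ ½))
    where
    columns : ΣΣ (λ a b → v a b * arc b x₀ x y) ≡ 0ℚ
    columns = trans (∑-comm (λ a b → v a b * arc b x₀ x y))
                    (ΣΣ-row-weighted (circulation-columns v-circ) (λ b → arc b x₀ x y))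

circulation-𝟎 : Circulation {n} 𝟎
circulation-𝟎 {n} = (λ _ _ → refl) , (λ _ → sum-zero n)

circulation-⊕ : {v w : Flow n} → Circulation v → Circulation w → Circulation (v ⊕ w)
circulation-⊕ {v = v} {w} (v-skew , v-rows) (w-skew , w-rows) =
  (λ x y → trans (cong₂ _+_ (v-skew x y) (w-skew x y)) (sym (ℚP.neg-distrib-+ (v x y) (w x y)))) ,
  (λ x → trans (∑-distrib-+ (v x) (w x)) (trans (cong₂ _+_ (v-rows x) (w-rows x)) (ℚP.+-identityʳ 0ℚ)))

circulation-⨁ : ∀ {k} {g : Fin k → Flow n} → (∀ i → Circulation (g i)) → Circulation (⨁ g)
circulation-⨁ {k = zero} g-circ = circulation-𝟎
circulation-⨁ {k = suc k} g-circ = circulation-⊕ (g-circ zero) (circulation-⨁ (g-circ ∘ suc))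

-- Choice functions

t-just : (d : Choice n) {x y z : Fin n} → d x y ≡ just z → t d x y ≡ δ z y
t-just d {x} {y} {z} dxy≡z rewrite dxy≡z with z ≟ y
... | yes _ = refl
... | no _ = refl

t-nothing : (d : Choice n) {x y : Fin n} → d x y ≡ nothing → t d x y ≡ ½
t-nothing d dxy≡nothing rewrite dxy≡nothing = refl

t-act : (π : Permutation′ n) (d : Choice n) (x y : Fin n) → t (act π d) x y ≡ t d (π ⟨$⟩ˡ x) (π ⟨$⟩ˡ y)
t-act π d x y = by-cases (d (π ⟨$⟩ˡ x) (π ⟨$⟩ˡ y)) refl
  where
  by-cases : ∀ r → d (π ⟨$⟩ˡ x) (π ⟨$⟩ˡ y) ≡ r → t (act π d) x y ≡ t d (π ⟨$⟩ˡ x) (π ⟨$⟩ˡ y)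
  by-cases nothing eq = trans (t-nothing (act π d) (cong (Maybe.map (π ⟨$⟩ʳ_)) eq)) (sym (t-nothing d eq))
  by-cases (just z) eq = trans (t-just (act π d) (cong (Maybe.map (π ⟨$⟩ʳ_)) eq))
    (trans (δ-perm (Perm.flip π) z y) (sym (t-just d eq)))

t-complementary : {c : Choice n} → IsChoice c → Complementary (t c)
t-complementary {c = c} c-choice x y x≢y = by-cases (c x y) refl
  where
  c-sym : ∀ {r} → c x y ≡ r → c y x ≡ r
  c-sym = trans (sym (proj₁ (c-choice x y x≢y)))
  by-cases : ∀ r → c x y ≡ r → t c x y + t c y x ≡ 1ℚ
  by-cases nothing cxy = cong₂ _+_ (t-nothing c cxy) (t-nothing c (c-sym cxy))
  by-cases (just z) cxy with proj₂ (c-choice x y x≢y) z cxy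
  ... | inj₁ refl = trans (cong₂ _+_ (trans (t-just c cxy) (δ-≢ x≢y)) (trans (t-just c (c-sym cxy)) (δ-diag z)))
                          (ℚP.+-identityˡ 1ℚ)
  ... | inj₂ refl = trans (cong₂ _+_ (trans (t-just c cxy) (δ-diag z)) (trans (t-just c (c-sym cxy)) (δ-≢ (x≢y ∘ sym))))
                          (ℚP.+-identityʳ 1ℚ)

t-binary : ∀ {n} {d : Choice n} → IsChoice d → Full d → ∀ x y → x ≢ y → t d x y ≡ 1ℚ ⊎ t d x y ≡ 0ℚ
t-binary {d = d} d-choice d-full x y x≢y with d-full x y x≢y
... | z , dxy with proj₂ (d-choice x y x≢y) z dxy
...   | inj₁ refl = inj₂ (trans (t-just d dxy) (δ-≢ x≢y))
...   | inj₂ refl = inj₁ (trans (t-just d dxy) (δ-diag z))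

maj-> : (T : Flow n) {x y : Fin n} → ½ ℚ.< T x y → maj T x y ≡ just y
maj-> T {x} {y} ½<T with ℚP.<-cmp ½ (T x y)
... | tri< _ _ _ = refl
... | tri≈ _ ½≡T _ = ⊥-elim (ℚP.<-irrefl ½≡T ½<T)
... | tri> _ _ T<½ = ⊥-elim (ℚP.<-asym ½<T T<½)

maj-≡ : (T : Flow n) {x y : Fin n} → T x y ≡ ½ → maj T x y ≡ nothing
maj-≡ T {x} {y} T≡½ with ℚP.<-cmp ½ (T x y)
... | tri< ½<T _ _ = ⊥-elim (ℚP.<-irrefl (sym T≡½) ½<T)
... | tri≈ _ _ _ = refl
... | tri> _ _ T<½ = ⊥-elim (ℚP.<-irrefl T≡½ T<½)

maj-< : (T : Flow n) {x y : Fin n} → T x y ℚ.< ½ → maj T x y ≡ just x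
maj-< T {x} {y} T<½ with ℚP.<-cmp ½ (T x y)
... | tri< ½<T _ _ = ⊥-elim (ℚP.<-asym T<½ ½<T)
... | tri≈ _ ½≡T _ = ⊥-elim (ℚP.<-irrefl (sym ½≡T) T<½)
... | tri> _ _ _ = refl

maj-just⇒> : (T : Flow n) {x y : Fin n} → x ≢ y → maj T x y ≡ just y → ½ ℚ.< T x y
maj-just⇒> T {x} {y} x≢y maj≡y with ℚP.<-cmp ½ (T x y)
maj-just⇒> T x≢y _ | tri< ½<T _ _ = ½<T
maj-just⇒> T x≢y () | tri≈ _ _ _
maj-just⇒> T x≢y maj≡y | tri> _ _ _ = ⊥-elim (x≢y (just-injective maj≡y))

½<⇒0<-½ : ∀ {a} → ½ ℚ.< a → 0ℚ ℚ.< a - ½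
½<⇒0<-½ ½<a = ℚP.≤-<-trans (ℚP.≤-reflexive (sym (ℚP.+-inverseʳ ½))) (ℚP.+-monoˡ-< (- ½) ½<a)

0<-½⇒½< : ∀ {a} → 0ℚ ℚ.< a - ½ → ½ ℚ.< a
0<-½⇒½< {a} 0<a-½ = ℚP.<-≤-trans (ℚP.+-monoˡ-< ½ 0<a-½) (ℚP.≤-reflexive (recentre a))
  where
  recentre : ∀ a → a - ½ + ½ ≡ a
  recentre = solve 1 (λ a → a :- con ½ :+ con ½ := a) refl

SignOf : Choice n → Flow n → Set
SignOf {n} c F = ∀ a b → a ≢ b → (c a b ≡ just b → 0ℚ ℚ.< F a b) × (c a b ≡ nothing → F a b ≡ 0ℚ)

centred-sign : {c : Choice n} → SignOf c (centred (t c))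
centred-sign {c = c} a b a≢b =
  (λ cab → subst (0ℚ ℚ.<_) (sym (trans (centred-≐ (t c) a b a≢b) (cong (_- ½) (trans (t-just c cab) (δ-diag b))))) (ℚP.positive⁻¹ ½)) ,
  (λ cab → trans (centred-≐ (t c) a b a≢b) (trans (cong (_- ½) (t-nothing c cab)) (ℚP.+-inverseʳ ½)))

edge? : (c : Choice n) (a b : Fin n) → Dec (Edge c a b)
edge? c a b = ¬? (a ≟ b) ×-dec ≡-dec _≟_ (c a b) (just b)

-- Permutations

⟨$⟩ˡ-≢ : (π : Permutation′ n) {x y : Fin n} → x ≢ y → π ⟨$⟩ˡ x ≢ π ⟨$⟩ˡ y
⟨$⟩ˡ-≢ π x≢y eq = x≢y (trans (sym (Perm.inverseʳ π)) (trans (cong (π ⟨$⟩ʳ_) eq) (Perm.inverseʳ π)))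

⟨$⟩ʳ-≢ : (π : Permutation′ n) {x y : Fin n} → x ≢ y → π ⟨$⟩ʳ x ≢ π ⟨$⟩ʳ y
⟨$⟩ʳ-≢ π = ⟨$⟩ˡ-≢ (Perm.flip π)

transpose-sends-i : (i j : Fin n) → transpose i j ⟨$⟩ʳ i ≡ j
transpose-sends-i i j rewrite dec-true (i ≟ i) refl = refl

transpose-sends-j : (i j : Fin n) → transpose i j ⟨$⟩ʳ j ≡ i
transpose-sends-j i j with j ≟ i
... | yes j≡i = j≡i
... | no j≢i rewrite dec-true (j ≟ j) refl = refl

transpose-fixes : {i j k : Fin n} → k ≢ i → k ≢ j → transpose i j ⟨$⟩ʳ k ≡ k
transpose-fixes {i = i} {j} {k} k≢i k≢j rewrite dec-false (k ≟ i) k≢i | dec-false (k ≟ j) k≢j = refl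

extend-permutation : (π : Permutation′ n) (s t : Fin n) → ∃ λ π′ → π′ ⟨$⟩ʳ s ≡ t ×
                     (∀ z → π ⟨$⟩ʳ z ≢ π ⟨$⟩ʳ s → π ⟨$⟩ʳ z ≢ t → π′ ⟨$⟩ʳ z ≡ π ⟨$⟩ʳ z)
extend-permutation π s t = π ∘ₚ transpose (π ⟨$⟩ʳ s) t , transpose-sends-i (π ⟨$⟩ʳ s) t , λ z → transpose-fixes

permutation-sending₂ : {a b a′ b′ : Fin n} → a ≢ b → a′ ≢ b′ →
                       ∃ λ π → π ⟨$⟩ʳ a ≡ a′ × π ⟨$⟩ʳ b ≡ b′
permutation-sending₂ {a = a} {b} {a′} {b′} a≢b a′≢b′ with extend-permutation Perm.id a a′
... | π₁ , π₁a , _ with extend-permutation π₁ b b′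
... | π₂ , π₂b , π₂-keeps = π₂ , trans (π₂-keeps a (⟨$⟩ʳ-≢ π₁ a≢b) (a′≢b′ ∘ trans (sym π₁a))) π₁a , π₂b

permutation-sending₃ : {a b c a′ b′ c′ : Fin n} → a ≢ b → a ≢ c → b ≢ c → a′ ≢ b′ → a′ ≢ c′ → b′ ≢ c′ →
                       ∃ λ π → π ⟨$⟩ʳ a ≡ a′ × π ⟨$⟩ʳ b ≡ b′ × π ⟨$⟩ʳ c ≡ c′
permutation-sending₃ {a = a} {b} {c} {a′} {b′} {c′} a≢b a≢c b≢c a′≢b′ a′≢c′ b′≢c′
  with permutation-sending₂ a≢b a′≢b′
... | π₂ , π₂a , π₂b with extend-permutation π₂ c c′
... | π₃ , π₃c , π₃-keeps =
  π₃ , trans (π₃-keeps a (⟨$⟩ʳ-≢ π₂ a≢c) (a′≢c′ ∘ trans (sym π₂a))) π₂a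
     , trans (π₃-keeps b (⟨$⟩ʳ-≢ π₂ b≢c) (b′≢c′ ∘ trans (sym π₂b))) π₂b , π₃c

module Dihedral (m : ℕ) where

  private
    %-absorbˡ : ∀ p a → (p % suc m ℕ.+ a) % suc m ≡ (p ℕ.+ a) % suc m
    %-absorbˡ p a = begin
      (p % suc m ℕ.+ a) % suc m                   ≡⟨ %-distribˡ-+ (p % suc m) a (suc m) ⟩
      (p % suc m % suc m ℕ.+ a % suc m) % suc m   ≡⟨ cong (λ q → (q ℕ.+ a % suc m) % suc m) (m%n%n≡m%n p (suc m)) ⟩
      (p % suc m ℕ.+ a % suc m) % suc m           ≡⟨ %-distribˡ-+ p a (suc m) ⟨
      (p ℕ.+ a) % suc m                           ∎
      where open ≡-Reasoning

    %-absorbʳ : ∀ a p → (a ℕ.+ p % suc m) % suc m ≡ (a ℕ.+ p) % suc m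
    %-absorbʳ a p = trans (cong (_% suc m) (ℕP.+-comm a _))
                          (trans (%-absorbˡ p a) (cong (_% suc m) (ℕP.+-comm p a)))

  shift : ℕ → Fin (suc m) → Fin (suc m)
  shift a z = (toℕ z ℕ.+ a) mod suc m

  toℕ-shift : ∀ a z → toℕ (shift a z) ≡ (toℕ z ℕ.+ a) % suc m
  toℕ-shift a z = FinP.toℕ-fromℕ< _

  shift-≡ : ∀ {a b x y} → (toℕ x ℕ.+ a) % suc m ≡ (toℕ y ℕ.+ b) % suc m → shift a x ≡ shift b y
  shift-≡ {a} {b} {x} {y} eq = FinP.toℕ-injective (trans (toℕ-shift a x) (trans eq (sym (toℕ-shift b y))))

  shift-shift : ∀ a b z → shift a (shift b z) ≡ shift (b ℕ.+ a) z
  shift-shift a b z = shift-≡ {a} {b ℕ.+ a} {shift b z} {z} (begin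
    (toℕ (shift b z) ℕ.+ a) % suc m          ≡⟨ cong (λ q → (q ℕ.+ a) % suc m) (toℕ-shift b z) ⟩
    ((toℕ z ℕ.+ b) % suc m ℕ.+ a) % suc m    ≡⟨ %-absorbˡ (toℕ z ℕ.+ b) a ⟩
    (toℕ z ℕ.+ b ℕ.+ a) % suc m              ≡⟨ cong (_% suc m) (ℕP.+-assoc (toℕ z) b a) ⟩
    (toℕ z ℕ.+ (b ℕ.+ a)) % suc m            ∎)
    where open ≡-Reasoning

  shift-full-turns : ∀ k z → shift (k ℕ.* suc m) z ≡ z
  shift-full-turns k z = FinP.toℕ-injective
    (trans (toℕ-shift _ z) (trans ([m+kn]%n≡m%n (toℕ z) k (suc m)) (m<n⇒m%n≡m (FinP.toℕ<n z))))

  shift-inverse : ∀ a z → shift (a ℕ.* m) (shift a z) ≡ z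
  shift-inverse a z = trans (shift-shift (a ℕ.* m) a z)
    (trans (cong (λ b → shift b z) (sym (ℕP.*-suc a m))) (shift-full-turns a z))

  shift-inverse′ : ∀ a z → shift a (shift (a ℕ.* m) z) ≡ z
  shift-inverse′ a z = trans (shift-shift a (a ℕ.* m) z)
    (trans (cong (λ b → shift b z) (trans (ℕP.+-comm (a ℕ.* m) a) (sym (ℕP.*-suc a m)))) (shift-full-turns a z))

  rotation : ℕ → Permutation′ (suc m)
  rotation a = permutation (shift (a ℕ.* m)) (shift a) (shift-inverse a) (shift-inverse′ a)

  reflection : ℕ → Permutation′ (suc m)
  reflection a = rotation a ∘ₚ Perm.reverse

  gap : Fin (suc m) → Fin (suc m) → ℕ
  gap x y = toℕ (opposite x) ℕ.+ suc (toℕ (opposite y))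

  gap-comm : ∀ x y → gap x y ≡ gap y x
  gap-comm x y = trans (ℕP.+-suc a b) (trans (cong suc (ℕP.+-comm a b)) (sym (ℕP.+-suc b a)))
    where
    a = toℕ (opposite x)
    b = toℕ (opposite y)

  opposite-as-shift : ∀ x y → opposite x ≡ shift (gap x y) y
  opposite-as-shift x y = FinP.toℕ-injective (sym (begin
    toℕ (shift (gap x y) y)              ≡⟨ toℕ-shift (gap x y) y ⟩
    (toℕ y ℕ.+ (a ℕ.+ suc b)) % suc m    ≡⟨ cong (_% suc m) (x∙yz≈y∙xz (toℕ y) a (suc b)) ⟩
    (a ℕ.+ (toℕ y ℕ.+ suc b)) % suc m    ≡⟨ cong (λ q → (a ℕ.+ q) % suc m) (trans (ℕP.+-suc (toℕ y) b) (cong suc y+b≡m)) ⟩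
    (a ℕ.+ suc m) % suc m                ≡⟨ [m+n]%n≡m%n a (suc m) ⟩
    a % suc m                            ≡⟨ m<n⇒m%n≡m (FinP.toℕ<n (opposite x)) ⟩
    a                                    ∎))
    where
    open ≡-Reasoning
    a = toℕ (opposite x)
    b = toℕ (opposite y)
    y+b≡m : toℕ y ℕ.+ b ≡ m
    y+b≡m = trans (cong (toℕ y ℕ.+_) (FinP.opposite-prop y)) (ℕP.m+[n∸m]≡n (ℕP.≤-pred (FinP.toℕ<n y)))

  reflection-as-rotation : ∀ k x y → shift (toℕ k) (opposite x) ≡ shift (toℕ (shift (gap x y) k)) y
  reflection-as-rotation k x y = begin
    shift (toℕ k) (opposite x)             ≡⟨ cong (shift (toℕ k)) (opposite-as-shift x y) ⟩
    shift (toℕ k) (shift (gap x y) y)      ≡⟨ shift-shift (toℕ k) (gap x y) y ⟩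
    shift (gap x y ℕ.+ toℕ k) y            ≡⟨ shift-≡ {gap x y ℕ.+ toℕ k} {toℕ (shift (gap x y) k)} {y} {y} (begin
      (toℕ y ℕ.+ (gap x y ℕ.+ toℕ k)) % suc m            ≡⟨ cong (λ q → (toℕ y ℕ.+ q) % suc m) (ℕP.+-comm (gap x y) (toℕ k)) ⟩
      (toℕ y ℕ.+ (toℕ k ℕ.+ gap x y)) % suc m            ≡⟨ %-absorbʳ (toℕ y) (toℕ k ℕ.+ gap x y) ⟨
      (toℕ y ℕ.+ (toℕ k ℕ.+ gap x y) % suc m) % suc m    ≡⟨ cong (λ q → (toℕ y ℕ.+ q) % suc m) (toℕ-shift (gap x y) k) ⟨
      (toℕ y ℕ.+ toℕ (shift (gap x y) k)) % suc m        ∎) ⟩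
    shift (toℕ (shift (gap x y) k)) y      ∎
    where open ≡-Reasoning

  shift-≢ : ∀ a {x y} → x ≢ y → shift a x ≢ shift a y
  shift-≢ a x≢y eq = x≢y (trans (sym (shift-inverse a _)) (trans (cong (shift (a ℕ.* m)) eq) (shift-inverse a _)))

  rotations+reflections≐𝟎 : (v : Flow (suc m)) → (∀ x y → x ≢ y → v y x ≡ - v x y) →
    ⨁ (λ (k : Fin (suc m)) → rotation (toℕ k) · v) ⊕ ⨁ (λ (k : Fin (suc m)) → reflection (toℕ k) · v) ≐ 𝟎
  rotations+reflections≐𝟎 v v-skew x y x≢y = trans (cong (R +_) reflections≡-R) (ℚP.+-inverseʳ R)
    where
    open ≡-Reasoning
    r : Fin (suc m) → ℚ
    r k = v (shift (toℕ k) x) (shift (toℕ k) y)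
    R = sum r
    h : Fin (suc m) → ℚ
    h k = v (shift (toℕ k) y) (shift (toℕ k) x)
    reflections≡-R : sum {suc m} (λ k → v (shift (toℕ k) (opposite x)) (shift (toℕ k) (opposite y))) ≡ - R
    reflections≡-R = begin
      sum {suc m} (λ k → v (shift (toℕ k) (opposite x)) (shift (toℕ k) (opposite y)))
        ≡⟨ sum-cong-≗ {suc m} (λ k → cong₂ v (reflection-as-rotation k x y)
             (trans (reflection-as-rotation k y x) (cong (λ g → shift (toℕ (shift g k)) x) (gap-comm y x)))) ⟩
      sum {suc m} (λ k → h (shift (gap x y) k))  ≡⟨ sum-permute h (Perm.flip (rotation (gap x y))) ⟨
      sum {suc m} h                              ≡⟨ sum-cong-≗ {suc m} (λ k → v-skew _ _ (shift-≢ (toℕ k) x≢y)) ⟩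
      sum (λ k → - r k)                  ≡⟨ sum-neg r ⟩
      - R                                ∎

-- Feasible directions of the convex hull

sumℚ-++ : {A : Set} (f : A → ℚ) (xs ys : List A) →
          sumℚ (mapL f (xs ++ ys)) ≡ sumℚ (mapL f xs) + sumℚ (mapL f ys)
sumℚ-++ f [] ys = sym (ℚP.+-identityˡ _)
sumℚ-++ f (x ∷ xs) ys = trans (cong (f x +_) (sumℚ-++ f xs ys)) (sym (ℚP.+-assoc (f x) _ _))

∈-mapL⁻ : {A B : Set} (f : A → B) {b : B} (xs : List A) → b ∈ mapL f xs → ∃ λ a → a ∈ xs × b ≡ f a
∈-mapL⁻ f (x ∷ xs) (here b≡fx) = x , here refl , b≡fx
∈-mapL⁻ f (x ∷ xs) (there b∈) with ∈-mapL⁻ f xs b∈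
... | a , a∈ , b≡fa = a , there a∈ , b≡fa

module Hull {n : ℕ} (D : Choice n → Set) where

  Weights : Set
  Weights = List (ℚ × Choice n)

  mass : Weights → ℚ
  mass ws = sumℚ (mapL proj₁ ws)

  average : Weights → (Choice n → ℚ) → ℚ
  average ws f = sumℚ (mapL (λ w → proj₁ w * f (proj₂ w)) ws)

  Admissible : Weights → Set
  Admissible ws = ∀ w → w ∈ ws → (0ℚ ℚ.≤ proj₁ w) × D (proj₂ w)

  scale : ℚ → Weights → Weights
  scale a = mapL (λ w → a * proj₁ w , proj₂ w)

  relabel : Permutation′ n → Weights → Weights
  relabel π = mapL (map₂ (act π))

  mass-scale : ∀ a ws → mass (scale a ws) ≡ a * mass ws
  mass-scale a [] = sym (ℚP.*-zeroʳ a)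
  mass-scale a (w ∷ ws) = trans (cong (a * proj₁ w +_) (mass-scale a ws)) (sym (ℚP.*-distribˡ-+ a _ _))

  average-scale : ∀ a ws f → average (scale a ws) f ≡ a * average ws f
  average-scale a [] f = sym (ℚP.*-zeroʳ a)
  average-scale a (w ∷ ws) f = trans (cong₂ _+_ (ℚP.*-assoc a (proj₁ w) _) (average-scale a ws f))
                                     (sym (ℚP.*-distribˡ-+ a _ _))

  average-cong : ∀ ws {f g : Choice n → ℚ} → (∀ d → f d ≡ g d) → average ws f ≡ average ws g
  average-cong [] f≗g = refl
  average-cong (w ∷ ws) f≗g = cong₂ (λ a b → proj₁ w * a + b) (f≗g (proj₂ w)) (average-cong ws f≗g)

  mass-relabel : ∀ π ws → mass (relabel π ws) ≡ mass ws
  mass-relabel π [] = refl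
  mass-relabel π (w ∷ ws) = cong (proj₁ w +_) (mass-relabel π ws)

  average-relabel : ∀ π ws f → average (relabel π ws) f ≡ average ws (f ∘ act π)
  average-relabel π [] f = refl
  average-relabel π (w ∷ ws) f = cong (proj₁ w * f (act π (proj₂ w)) +_) (average-relabel π ws f)

  admissible-++ : ∀ xs ys → Admissible xs → Admissible ys → Admissible (xs ++ ys)
  admissible-++ xs ys adm-xs adm-ys w w∈ with ∈-++⁻ xs w∈
  ... | inj₁ w∈xs = adm-xs w w∈xs
  ... | inj₂ w∈ys = adm-ys w w∈ys

  admissible-scale : ∀ {a} ws → 0ℚ ℚ.≤ a → Admissible ws → Admissible (scale a ws)
  admissible-scale ws a≥0 adm w w∈ with ∈-mapL⁻ _ ws w∈
  ... | w′ , w′∈ , refl = *-nonneg a≥0 (proj₁ (adm w′ w′∈)) , proj₂ (adm w′ w′∈)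

  admissible-relabel : Symmetric D → ∀ π ws → Admissible ws → Admissible (relabel π ws)
  admissible-relabel D-sym π ws adm w w∈ with ∈-mapL⁻ _ ws w∈
  ... | w′ , w′∈ , refl = proj₁ (adm w′ w′∈) , D-sym π (proj₂ w′) (proj₂ (adm w′ w′∈))

  average-complementary : ∀ ws (f g : Choice n → ℚ) → (∀ d → D d → f d + g d ≡ 1ℚ) →
                          Admissible ws → average ws f + average ws g ≡ mass ws
  average-complementary [] f g f+g≡1 adm = refl
  average-complementary (w ∷ ws) f g f+g≡1 adm = begin
    (p * f d + average ws f) + (p * g d + average ws g)  ≡⟨ regroup p (f d) (g d) (average ws f) (average ws g) ⟩
    p * (f d + g d) + (average ws f + average ws g)      ≡⟨ cong₂ (λ s r → p * s + r) (f+g≡1 d (proj₂ (adm w (here refl))))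
                                                             (average-complementary ws f g f+g≡1 (λ w′ → adm w′ ∘ there)) ⟩
    p * 1ℚ + mass ws                                     ≡⟨ cong (_+ mass ws) (ℚP.*-identityʳ p) ⟩
    p + mass ws                                          ∎
    where
    open ≡-Reasoning
    p = proj₁ w
    d = proj₂ w
    regroup : ∀ p a b c e → (p * a + c) + (p * b + e) ≡ p * (a + b) + (c + e)
    regroup = solve 5 (λ p a b c e → (p :* a :+ c) :+ (p :* b :+ e) := p :* (a :+ b) :+ (c :+ e)) refl

  average-centred : ∀ ws e (f : Choice n → ℚ) → average ws (λ d → e * (f d - ½)) ≡ e * (average ws f - ½ * mass ws)
  average-centred [] e f = solve 1 (λ e → con 0ℚ := e :* (con 0ℚ :- con ½ :* con 0ℚ)) refl e
  average-centred (w ∷ ws) e f = trans (cong (proj₁ w * (e * (f (proj₂ w) - ½)) +_) (average-centred ws e f))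
    (solve 5 (λ p e a A M → p :* (e :* (a :- con ½)) :+ e :* (A :- con ½ :* M) := e :* ((p :* a :+ A) :- con ½ :* (p :+ M))) refl
             (proj₁ w) e (f (proj₂ w)) (average ws f) (mass ws))

  average-sum : ∀ ws {k} (g : Choice n → Fin k → ℚ) → sum (λ b → average ws (λ d → g d b)) ≡ average ws (λ d → sum (g d))
  average-sum [] {k} g = sum-zero k
  average-sum (w ∷ ws) g = trans (∑-distrib-+ (λ b → proj₁ w * g (proj₂ w) b) (λ b → average ws (λ d → g d b)))
                                 (cong₂ _+_ (sum-*ˡ (proj₁ w) (g (proj₂ w))) (average-sum ws g))

  average-vanishes : ∀ ws (f : Choice n → ℚ) → (∀ w → w ∈ ws → f (proj₂ w) ≡ 0ℚ) → average ws f ≡ 0ℚ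
  average-vanishes [] f f≡0 = refl
  average-vanishes (w ∷ ws) f f≡0 =
    trans (cong₂ _+_ (trans (cong (proj₁ w *_) (f≡0 w (here refl))) (ℚP.*-zeroʳ (proj₁ w)))
                     (average-vanishes ws f (λ w′ → f≡0 w′ ∘ there)))
          (ℚP.+-identityʳ 0ℚ)

  inPrCl-≐ : ∀ {T T′} → InPrCl D T → T ≐ T′ → InPrCl D T′
  inPrCl-≐ (ws , adm , unit , T≡) T≐T′ = ws , adm , unit , λ x y x≢y → trans (sym (T≐T′ x y x≢y)) (T≡ x y x≢y)

  inPrCl-vertex : ∀ {d} → D d → InPrCl D (t d)
  inPrCl-vertex {d} Dd = (1ℚ , d) ∷ [] , adm , refl , λ x y _ → sym (trans (ℚP.+-identityʳ _) (ℚP.*-identityˡ _))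
    where
    adm : Admissible ((1ℚ , d) ∷ [])
    adm _ (here refl) = ℚP.<⇒≤ (ℚP.positive⁻¹ 1ℚ) , Dd

  inPrCl-mix : ∀ {T₁ T₂} a b → 0ℚ ℚ.≤ a → 0ℚ ℚ.≤ b → a + b ≡ 1ℚ →
               InPrCl D T₁ → InPrCl D T₂ → InPrCl D (a ⊛ T₁ ⊕ b ⊛ T₂)
  inPrCl-mix {T₁} {T₂} a b a≥0 b≥0 a+b≡1 (ws₁ , adm₁ , unit₁ , T₁≡) (ws₂ , adm₂ , unit₂ , T₂≡) =
    ws , admissible-++ (scale a ws₁) (scale b ws₂) (admissible-scale ws₁ a≥0 adm₁) (admissible-scale ws₂ b≥0 adm₂) ,
    unit , T≡
    where
    ws = scale a ws₁ ++ scale b ws₂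
    unit : mass ws ≡ 1ℚ
    unit = begin
      mass ws                                    ≡⟨ sumℚ-++ proj₁ (scale a ws₁) (scale b ws₂) ⟩
      mass (scale a ws₁) + mass (scale b ws₂)    ≡⟨ cong₂ _+_ (mass-scale a ws₁) (mass-scale b ws₂) ⟩
      a * mass ws₁ + b * mass ws₂                ≡⟨ cong₂ (λ p q → a * p + b * q) unit₁ unit₂ ⟩
      a * 1ℚ + b * 1ℚ                            ≡⟨ cong₂ _+_ (ℚP.*-identityʳ a) (ℚP.*-identityʳ b) ⟩
      a + b                                      ≡⟨ a+b≡1 ⟩
      1ℚ                                         ∎
      where open ≡-Reasoning
    T≡ : ∀ x y → x ≢ y → (a ⊛ T₁ ⊕ b ⊛ T₂) x y ≡ average ws (λ d → t d x y)
    T≡ x y x≢y = sym (begin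
      average ws f                                       ≡⟨ sumℚ-++ _ (scale a ws₁) (scale b ws₂) ⟩
      average (scale a ws₁) f + average (scale b ws₂) f  ≡⟨ cong₂ _+_ (average-scale a ws₁ f) (average-scale b ws₂ f) ⟩
      a * average ws₁ f + b * average ws₂ f              ≡⟨ cong₂ (λ p q → a * p + b * q) (sym (T₁≡ x y x≢y)) (sym (T₂≡ x y x≢y)) ⟩
      _                                                  ∎)
      where
      open ≡-Reasoning
      f = λ d → t d x y

  inPrCl-act : Symmetric D → ∀ {T} π → InPrCl D T → InPrCl D (π · T)
  inPrCl-act D-sym π (ws , adm , unit , T≡) =
    relabel π ws , admissible-relabel D-sym π ws adm , trans (mass-relabel π ws) unit ,
    λ x y x≢y → trans (T≡ _ _ (⟨$⟩ˡ-≢ π x≢y)) (sym (trans (average-relabel π ws _) (average-cong ws (λ d → t-act π d x y))))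

  inPrCl-complementary : (∀ d → D d → IsChoice d) → ∀ {T} → InPrCl D T → Complementary T
  inPrCl-complementary D-choice (ws , adm , unit , T≡) x y x≢y =
    trans (cong₂ _+_ (T≡ x y x≢y) (T≡ y x (x≢y ∘ sym)))
          (trans (average-complementary ws _ _ (λ d Dd → t-complementary (D-choice d Dd) x y x≢y) adm) unit)

module Cone {m : ℕ} (D : Choice (suc m) → Set)
            (D-choice : ∀ d → D d → IsChoice d) (D-sym : Symmetric D) where

  open Hull D

  Feasible : Flow (suc m) → Set
  Feasible v = ∃ λ ε → 0ℚ ℚ.< ε × InPrCl D (λ x y → ½ + ε * v x y)

  feasible-≐ : ∀ {v w} → Feasible v → v ≐ w → Feasible w
  feasible-≐ (ε , ε>0 , P) v≐w = ε , ε>0 , inPrCl-≐ P (λ x y x≢y → cong (λ q → ½ + ε * q) (v≐w x y x≢y))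

  feasible-act : ∀ {v} π → Feasible v → Feasible (π · v)
  feasible-act π (ε , ε>0 , P) = ε , ε>0 , inPrCl-act D-sym π P

  feasible-centred : ∀ {T} → InPrCl D T → Feasible (centred T)
  feasible-centred {T} P = 1ℚ , ℚP.positive⁻¹ 1ℚ , inPrCl-≐ P (λ x y x≢y →
    trans (recentre (T x y)) (cong (λ q → ½ + 1ℚ * q) (sym (centred-≐ T x y x≢y))))
    where
    recentre : ∀ a → a ≡ ½ + 1ℚ * (a - ½)
    recentre = solve 1 (λ a → a := con ½ :+ con 1ℚ :* (a :- con ½)) refl

  feasible-skew : ∀ {v} → Feasible v → ∀ x y → x ≢ y → v y x ≡ - v x y
  feasible-skew {v} (ε , ε>0 , P) x y x≢y = begin
    b            ≡⟨ solve 2 (λ a b → b := (a :+ b) :- a) refl a b ⟩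
    (a + b) - a  ≡⟨ cong (_- a) a+b≡0 ⟩
    0ℚ - a       ≡⟨ ℚP.+-identityˡ (- a) ⟩
    - a          ∎
    where
    open ≡-Reasoning
    a = v x y
    b = v y x
    expand : ∀ ε a b → ε * (a + b) ≡ ((½ + ε * a) + (½ + ε * b)) - 1ℚ
    expand = solve 3 (λ ε a b → ε :* (a :+ b) := ((con ½ :+ ε :* a) :+ (con ½ :+ ε :* b)) :- con 1ℚ) refl
    ε[a+b]≡0 : ε * (a + b) ≡ 0ℚ
    ε[a+b]≡0 = trans (expand ε a b)
      (trans (cong (_- 1ℚ) (inPrCl-complementary D-choice P x y x≢y)) (ℚP.+-inverseʳ 1ℚ))
    a+b≡0 : a + b ≡ 0ℚ
    a+b≡0 = trans (sym (inverse-cancelˡ ε (pos⇒≢0 ε>0) (a + b)))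
                  (trans (cong (inverse ε (pos⇒≢0 ε>0) *_) ε[a+b]≡0) (ℚP.*-zeroʳ (inverse ε (pos⇒≢0 ε>0))))

  -- Mixing ½ + ε₁·v and ½ + ε₂·w with weights proportional to ε₂ and ε₁ gives ½ + ε₁ε₂/(ε₁ + ε₂)·(v + w).
  feasible-⊕ : ∀ {v w} → Feasible v → Feasible w → Feasible (v ⊕ w)
  feasible-⊕ {v} {w} (ε₁ , ε₁>0 , P₁) (ε₂ , ε₂>0 , P₂) =
    ε₁ * ε₂ * i , *-pos (*-pos ε₁>0 ε₂>0) i>0 ,
    inPrCl-≐ (inPrCl-mix (ε₂ * i) (ε₁ * i) (ℚP.<⇒≤ (*-pos ε₂>0 i>0)) (ℚP.<⇒≤ (*-pos ε₁>0 i>0)) weights P₁ P₂)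
             (λ x y _ → mixed (v x y) (w x y))
    where
    s>0 : 0ℚ ℚ.< ε₁ + ε₂
    s>0 = ℚP.+-mono-< ε₁>0 ε₂>0
    i = inverse (ε₁ + ε₂) (pos⇒≢0 s>0)
    i>0 = inverse-pos s>0
    weights : ε₂ * i + ε₁ * i ≡ 1ℚ
    weights = trans (solve 3 (λ e₁ e₂ i → e₂ :* i :+ e₁ :* i := i :* (e₁ :+ e₂)) refl ε₁ ε₂ i)
                    (inverse-*ˡ (ε₁ + ε₂) (pos⇒≢0 s>0))
    expand : ∀ e₁ e₂ i a b → (e₂ * i) * (½ + e₁ * a) + (e₁ * i) * (½ + e₂ * b) ≡
                             ½ * (e₂ * i + e₁ * i) + e₁ * e₂ * i * (a + b)
    expand = solve 5 (λ e₁ e₂ i a b → (e₂ :* i) :* (con ½ :+ e₁ :* a) :+ (e₁ :* i) :* (con ½ :+ e₂ :* b)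
                                      := con ½ :* (e₂ :* i :+ e₁ :* i) :+ e₁ :* e₂ :* i :* (a :+ b)) refl
    mixed : ∀ a b → (ε₂ * i) * (½ + ε₁ * a) + (ε₁ * i) * (½ + ε₂ * b) ≡ ½ + ε₁ * ε₂ * i * (a + b)
    mixed a b = trans (expand ε₁ ε₂ i a b)
      (cong (_+ ε₁ * ε₂ * i * (a + b)) (trans (cong (½ *_) weights) (ℚP.*-identityʳ ½)))

  feasible-pos : ∀ {v} q → 0ℚ ℚ.< q → Feasible v → Feasible (q ⊛ v)
  feasible-pos {v} q q>0 (ε , ε>0 , P) = ε * q⁻¹ , *-pos ε>0 (inverse-pos q>0) ,
    inPrCl-≐ P (λ x y _ → cong (½ +_) (sym (rescale (v x y))))
    where
    q⁻¹ = inverse q (pos⇒≢0 q>0)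
    rescale : ∀ a → ε * q⁻¹ * (q * a) ≡ ε * a
    rescale a = trans (solve 4 (λ e i q a → e :* i :* (q :* a) := e :* (i :* q :* a)) refl ε q⁻¹ q a)
                      (cong (ε *_) (trans (cong (_* a) (inverse-*ˡ q (pos⇒≢0 q>0))) (ℚP.*-identityˡ a)))

  feasible-⨁⊕ : ∀ {k} {g : Fin k → Flow (suc m)} {w} → (∀ i → Feasible (g i)) → Feasible w → Feasible (⨁ g ⊕ w)
  feasible-⨁⊕ {zero} g-feasible w-feasible = feasible-≐ w-feasible (λ x y _ → sym (ℚP.+-identityˡ _))
  feasible-⨁⊕ {suc k} {g} {w} g-feasible w-feasible =
    feasible-≐ (feasible-⊕ (g-feasible zero) (feasible-⨁⊕ (g-feasible ∘ suc) w-feasible))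
               (λ x y _ → sym (ℚP.+-assoc (g zero x y) _ (w x y)))

  feasible-⨁⁺ : ∀ {k} {g : Fin (suc k) → Flow (suc m)} → (∀ i → Feasible (g i)) → Feasible (⨁ g)
  feasible-⨁⁺ {g = g} g-feasible = feasible-≐ (feasible-⨁⊕ (λ i → g-feasible (suc i)) (g-feasible zero))
                                              (λ x y _ → ℚP.+-comm _ (g zero x y))

  open Dihedral m

  -- The dihedral images of v sum to zero, so −v is the sum of those other than v itself.
  feasible-neg : ∀ {v} → Feasible v → Feasible (⊖ v)
  feasible-neg {v} v-feasible = feasible-≐
    (feasible-⨁⊕ (λ (i : Fin m) → feasible-act (rotation (toℕ (suc i))) v-feasible)
                 (feasible-⨁⁺ (λ (k : Fin (suc m)) → feasible-act (reflection (toℕ k)) v-feasible)))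
    (λ x y x≢y → trans (isolate (v (shift 0 x) (shift 0 y)) _ _)
       (trans (cong₂ (λ p q → p - q) (rotations+reflections≐𝟎 v (feasible-skew v-feasible) x y x≢y)
                                     (cong₂ v (shift-full-turns 0 x) (shift-full-turns 0 y)))
              (ℚP.+-identityˡ (- v x y))))
    where
    isolate : ∀ a b c → b + c ≡ ((a + b) + c) - a
    isolate = solve 3 (λ a b c → b :+ c := ((a :+ b) :+ c) :- a) refl

  feasible-𝟎 : ∀ {v} → Feasible v → Feasible 𝟎
  feasible-𝟎 {v} v-feasible = feasible-≐ (feasible-⊕ v-feasible (feasible-neg v-feasible)) (λ x y _ → ℚP.+-inverseʳ (v x y))

  feasible-⊛ : ∀ {v} → Feasible v → ∀ q → Feasible (q ⊛ v)
  feasible-⊛ {v} v-feasible q with ℚP.<-cmp 0ℚ q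
  ... | tri< q>0 _ _ = feasible-pos q q>0 v-feasible
  ... | tri≈ _ refl _ = feasible-≐ (feasible-𝟎 v-feasible) (λ x y _ → sym (ℚP.*-zeroˡ (v x y)))
  ... | tri> _ _ q<0 = feasible-≐ (feasible-pos (- q) (ℚP.neg-antimono-< q<0) (feasible-neg v-feasible))
                                  (λ x y _ → negate-both q (v x y))
    where
    negate-both : ∀ q a → - q * - a ≡ q * a
    negate-both = solve 2 (λ q a → (:- q) :* (:- a) := q :* a) refl

  feasible-⊛⁻¹ : ∀ {v q} → q ≢ 0ℚ → Feasible (q ⊛ v) → Feasible v
  feasible-⊛⁻¹ {v} {q} q≢0 qv-feasible =
    feasible-≐ (feasible-⊛ qv-feasible (inverse q q≢0)) (λ x y _ → inverse-cancelˡ q q≢0 (v x y))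

  feasible-⨁ : ∀ {k} {g : Fin k → Flow (suc m)} → Feasible 𝟎 → (∀ i → Feasible (g i)) → Feasible (⨁ g)
  feasible-⨁ 𝟎-feasible g-feasible = feasible-≐ (feasible-⨁⊕ g-feasible 𝟎-feasible) (λ x y _ → ℚP.+-identityʳ _)

-- Circulations are feasible

module _ {k : ℕ} where
  τ₀₁ τ₁₂ τ₀₂ ρ : Permutation′ (suc (suc (suc k)))
  τ₀₁ = transpose 0F 1F
  τ₁₂ = transpose 1F 2F
  τ₀₂ = transpose 0F 2F
  ρ = τ₀₁ ∘ₚ τ₁₂

  alternating : Flow (suc (suc (suc k))) → Flow (suc (suc (suc k)))
  alternating u = u ⊕ ρ · u ⊕ ρ · ρ · u ⊕ ⊖ (τ₀₁ · u) ⊕ ⊖ (τ₁₂ · u) ⊕ ⊖ (τ₀₂ · u)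

  triangle-sum : Flow (suc (suc (suc k))) → ℚ
  triangle-sum u = u 0F 1F + u 1F 2F + u 2F 0F

  -- Entries leaving the triangle cancel between the cosets of ρ, and odd permutations reverse the
  -- triangle, so both cosets contribute its circulation.
  alternating-identity : (u : Flow (suc (suc (suc k)))) → (∀ x y → x ≢ y → u y x ≡ - u x y) →
    alternating u ≐ (triangle-sum u + triangle-sum u) ⊛ triangle 0F 1F 2F
  alternating-identity u u-skew = by-cases
    where
    s = triangle-sum u
    a = u 0F 1F
    b = u 1F 2F
    c = u 2F 0F
    orbit₀ : ∀ p q r → p + q + r + - q + - p + - r ≡ 0ℚ
    orbit₁ : ∀ p q r → q + r + p + - p + - r + - q ≡ 0ℚ
    orbit₂ : ∀ p q r → r + p + q + - r + - q + - p ≡ 0ℚ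
    orbit₀ = solve 3 (λ p q r → p :+ q :+ r :+ (:- q) :+ (:- p) :+ (:- r) := con 0ℚ) refl
    orbit₁ = solve 3 (λ p q r → q :+ r :+ p :+ (:- p) :+ (:- r) :+ (:- q) := con 0ℚ) refl
    orbit₂ = solve 3 (λ p q r → r :+ p :+ q :+ (:- r) :+ (:- q) :+ (:- p) := con 0ℚ) refl
    fixed : ∀ p → p + p + p + - p + - p + - p ≡ 0ℚ
    fixed = solve 1 (λ p → p :+ p :+ p :+ (:- p) :+ (:- p) :+ (:- p) := con 0ℚ) refl
    vanishes : ∀ {l} → l ≡ 0ℚ → l ≡ (s + s) * 0ℚ
    vanishes l≡0 = trans l≡0 (sym (ℚP.*-zeroʳ (s + s)))
    by-cases : alternating u ≐ (s + s) ⊛ triangle 0F 1F 2F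
    by-cases 0F 0F 0≢0 = ⊥-elim (0≢0 refl)
    by-cases 1F 1F 1≢1 = ⊥-elim (1≢1 refl)
    by-cases 2F 2F 2≢2 = ⊥-elim (2≢2 refl)
    by-cases 0F 1F _ rewrite u-skew 0F 1F (λ ()) | u-skew 2F 0F (λ ()) | u-skew 1F 2F (λ ()) =
      solve 3 (λ a b c → a :+ b :+ c :+ (:- (:- a)) :+ (:- (:- c)) :+ (:- (:- b)) := (a :+ b :+ c :+ (a :+ b :+ c)) :* con 1ℚ) refl a b c
    by-cases 1F 0F _ rewrite u-skew 0F 1F (λ ()) | u-skew 2F 0F (λ ()) | u-skew 1F 2F (λ ()) =
      solve 3 (λ a b c → (:- a) :+ (:- b) :+ (:- c) :+ (:- a) :+ (:- c) :+ (:- b) := (a :+ b :+ c :+ (a :+ b :+ c)) :* con (- 1ℚ)) refl a b c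
    by-cases 0F 2F _ rewrite u-skew 0F 1F (λ ()) | u-skew 2F 0F (λ ()) | u-skew 1F 2F (λ ()) =
      solve 3 (λ a b c → (:- c) :+ (:- a) :+ (:- b) :+ (:- b) :+ (:- a) :+ (:- c) := (a :+ b :+ c :+ (a :+ b :+ c)) :* con (- 1ℚ)) refl a b c
    by-cases 2F 0F _ rewrite u-skew 0F 1F (λ ()) | u-skew 2F 0F (λ ()) | u-skew 1F 2F (λ ()) =
      solve 3 (λ a b c → c :+ a :+ b :+ (:- (:- b)) :+ (:- (:- a)) :+ (:- (:- c)) := (a :+ b :+ c :+ (a :+ b :+ c)) :* con 1ℚ) refl a b c
    by-cases 1F 2F _ rewrite u-skew 0F 1F (λ ()) | u-skew 2F 0F (λ ()) | u-skew 1F 2F (λ ()) =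
      solve 3 (λ a b c → b :+ c :+ a :+ (:- (:- c)) :+ (:- (:- b)) :+ (:- (:- a)) := (a :+ b :+ c :+ (a :+ b :+ c)) :* con 1ℚ) refl a b c
    by-cases 2F 1F _ rewrite u-skew 0F 1F (λ ()) | u-skew 2F 0F (λ ()) | u-skew 1F 2F (λ ()) =
      solve 3 (λ a b c → (:- b) :+ (:- c) :+ (:- a) :+ (:- c) :+ (:- b) :+ (:- a) := (a :+ b :+ c :+ (a :+ b :+ c)) :* con (- 1ℚ)) refl a b c
    by-cases 0F w@(suc (suc (suc _))) _ = vanishes (orbit₀ (u 0F w) (u 1F w) (u 2F w))
    by-cases 1F w@(suc (suc (suc _))) _ = vanishes (orbit₁ (u 0F w) (u 1F w) (u 2F w))
    by-cases 2F w@(suc (suc (suc _))) _ = vanishes (orbit₂ (u 0F w) (u 1F w) (u 2F w))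
    by-cases w@(suc (suc (suc _))) 0F _ = vanishes (orbit₀ (u w 0F) (u w 1F) (u w 2F))
    by-cases w@(suc (suc (suc _))) 1F _ = vanishes (orbit₁ (u w 0F) (u w 1F) (u w 2F))
    by-cases w@(suc (suc (suc _))) 2F _ = vanishes (orbit₂ (u w 0F) (u w 1F) (u w 2F))
    by-cases w@(suc (suc (suc _))) w′@(suc (suc (suc _))) _ = vanishes (fixed (u w w′))

Half : ℚ → Set
Half q = q ≡ ½ ⊎ q ≡ - ½

doubled-three-halves≢0 : ∀ {a b c} → Half a → Half b → Half c → (a + b + c) + (a + b + c) ≢ 0ℚ
doubled-three-halves≢0 (inj₁ refl) (inj₁ refl) (inj₁ refl) ()
doubled-three-halves≢0 (inj₁ refl) (inj₁ refl) (inj₂ refl) ()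
doubled-three-halves≢0 (inj₁ refl) (inj₂ refl) (inj₁ refl) ()
doubled-three-halves≢0 (inj₁ refl) (inj₂ refl) (inj₂ refl) ()
doubled-three-halves≢0 (inj₂ refl) (inj₁ refl) (inj₁ refl) ()
doubled-three-halves≢0 (inj₂ refl) (inj₁ refl) (inj₂ refl) ()
doubled-three-halves≢0 (inj₂ refl) (inj₂ refl) (inj₁ refl) ()
doubled-three-halves≢0 (inj₂ refl) (inj₂ refl) (inj₂ refl) ()

centred-t-half : ∀ {n} {d : Choice n} → IsChoice d → Full d → ∀ x y → x ≢ y → Half (centred (t d) x y)
centred-t-half {d = d} d-choice d-full x y x≢y with t-binary d-choice d-full x y x≢y
... | inj₁ t≡1 = inj₁ (trans (centred-≐ (t d) x y x≢y) (cong (_- ½) t≡1))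
... | inj₂ t≡0 = inj₂ (trans (centred-≐ (t d) x y x≢y) (cong (_- ½) t≡0))

triangle-degenerate : ∀ {n} {a b c : Fin n} → a ≡ b ⊎ a ≡ c ⊎ b ≡ c → triangle a b c ≐ 𝟎
triangle-degenerate {a = a} {c = c} (inj₁ refl) x y _ =
  solve 4 (λ p q r s → p :* q :- p :* q :+ (p :* s :- r :* q) :+ (r :* q :- p :* s) := con 0ℚ) refl (δ x a) (δ y a) (δ x c) (δ y c)
triangle-degenerate {a = a} {b} (inj₂ (inj₁ refl)) x y _ =
  solve 4 (λ p q r s → p :* s :- r :* q :+ (r :* q :- p :* s) :+ (p :* q :- p :* q) := con 0ℚ) refl (δ x a) (δ y a) (δ x b) (δ y b)
triangle-degenerate {a = a} {b} (inj₂ (inj₂ refl)) x y _ =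
  solve 4 (λ p q r s → p :* s :- r :* q :+ (r :* s :- r :* s) :+ (r :* q :- p :* s) := con 0ℚ) refl (δ x a) (δ y a) (δ x b) (δ y b)

module Triangles {k : ℕ} (D : Choice (suc (suc (suc k))) → Set)
                 (D-choice : ∀ d → D d → IsChoice d) (D-sym : Symmetric D)
                 {d : Choice (suc (suc (suc k)))} (Dd : D d) (d-full : Full d) where

  open Cone D D-choice D-sym

  feasible-triangle₀₁₂ : Feasible (triangle 0F 1F 2F)
  feasible-triangle₀₁₂ = feasible-⊛⁻¹ (doubled-three-halves≢0 (half 0F 1F (λ ())) (half 1F 2F (λ ())) (half 2F 0F (λ ())))
    (feasible-≐ alternating-feasible (alternating-identity u (feasible-skew u-feasible)))
    where
    u = centred (t d)
    half = centred-t-half (D-choice d Dd) d-full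
    u-feasible : Feasible u
    u-feasible = feasible-centred (Hull.inPrCl-vertex D Dd)
    alternating-feasible : Feasible (alternating u)
    alternating-feasible =
      feasible-⊕ (feasible-⊕ (feasible-⊕ (feasible-⊕ (feasible-⊕ u-feasible (feasible-act ρ u-feasible))
                                                      (feasible-act ρ (feasible-act ρ u-feasible)))
                                         (feasible-neg (feasible-act τ₀₁ u-feasible)))
                             (feasible-neg (feasible-act τ₁₂ u-feasible)))
                 (feasible-neg (feasible-act τ₀₂ u-feasible))

  𝟎-feasible : Feasible 𝟎
  𝟎-feasible = feasible-𝟎 feasible-triangle₀₁₂

  feasible-triangle : ∀ a b c → Feasible (triangle a b c)
  feasible-triangle a b c with a ≟ b | a ≟ c | b ≟ c
  ... | yes a≡b | _ | _ = feasible-≐ 𝟎-feasible (λ x y x≢y → sym (triangle-degenerate (inj₁ a≡b) x y x≢y))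
  ... | no _ | yes a≡c | _ = feasible-≐ 𝟎-feasible (λ x y x≢y → sym (triangle-degenerate (inj₂ (inj₁ a≡c)) x y x≢y))
  ... | no _ | no _ | yes b≡c = feasible-≐ 𝟎-feasible (λ x y x≢y → sym (triangle-degenerate (inj₂ (inj₂ b≡c)) x y x≢y))
  ... | no a≢b | no a≢c | no b≢c with permutation-sending₃ {a = 0F} {1F} {2F} (λ ()) (λ ()) (λ ()) a≢b a≢c b≢c
  ...   | π , refl , refl , refl = feasible-≐ (feasible-act π feasible-triangle₀₁₂) (triangle-act π 0F 1F 2F)

  feasible-circulation : ∀ {v} → Circulation v → Feasible v
  feasible-circulation {v} v-circ =
    feasible-≐ (feasible-⨁ 𝟎-feasible (λ a → feasible-⨁ 𝟎-feasible (λ b → feasible-⊛ (feasible-triangle 0F a b) (½ * v a b))))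
               (λ x y _ → circulation-decomposition v-circ 0F x y)

-- Unbalanced members make every skew flow feasible

module Wins {n : ℕ} (d : Choice n) (x : Fin n) where

  chosen : Fin n → ℚ
  chosen y with y ≟ x | ≡-dec _≟_ (d x y) (just y)
  ... | no _ | yes _ = 1ℚ
  ... | _    | _     = 0ℚ

  -- `wins` counts with a local function that cannot be named; unification names it `count`.
  private
    mutual
      count : List (Fin n) → ℕ
      count = _

      wins-count : ∀ L → allFin n ≡ L → wins d x ≡ count L
      wins-count L allFin≡L with allFin n
      wins-count L refl | .L = refl

    ι-count : ∀ L → ι (count L) ≡ sumℚ (mapL chosen L)
    ι-count [] = refl
    ι-count (y ∷ ys) with y ≟ x | ≡-dec _≟_ (d x y) (just y)
    ... | no _  | yes _ = cong (1ℚ +_) (ι-count ys)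
    ... | yes _ | _     = trans (ι-count ys) (sym (ℚP.+-identityˡ _))
    ... | no _  | no _  = trans (ι-count ys) (sym (ℚP.+-identityˡ _))

    sumℚ-tabulate : ∀ {k} (g : Fin k → Fin n) → sumℚ (mapL chosen (tabulate g)) ≡ sum (chosen ∘ g)
    sumℚ-tabulate {zero} g = refl
    sumℚ-tabulate {suc k} g = cong (chosen (g zero) +_) (sumℚ-tabulate (g ∘ suc))

  ι-wins : ι (wins d x) ≡ sum chosen
  ι-wins = trans (cong ι (wins-count (allFin n) refl)) (trans (ι-count (allFin n)) (sumℚ-tabulate (λ y → y)))

  chosen-t : IsChoice d → Full d → ∀ y → chosen y ≡ (1ℚ - δ x y) * t d x y
  chosen-t d-choice d-full y with y ≟ x | ≡-dec _≟_ (d x y) (just y)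
  ... | yes refl | _ = sym (trans (cong (λ e → (1ℚ - e) * t d y y) (δ-diag y)) (ℚP.*-zeroˡ (t d y y)))
  ... | no y≢x | yes dxy≡y = sym (trans (cong₂ (λ e s → (1ℚ - e) * s) (δ-≢ (y≢x ∘ sym)) (trans (t-just d dxy≡y) (δ-diag y)))
                                        refl)
  ... | no y≢x | no dxy≢y with d-full x y (y≢x ∘ sym)
  ...   | z , dxy≡z with proj₂ (d-choice x y (y≢x ∘ sym)) z dxy≡z
  ...     | inj₁ refl = sym (trans (cong₂ (λ e s → (1ℚ - e) * s) (δ-≢ (y≢x ∘ sym)) (trans (t-just d dxy≡z) (δ-≢ (y≢x ∘ sym))))
                                   refl)
  ...     | inj₂ refl = ⊥-elim (dxy≢y dxy≡z)

2w≡m⇒ιw-½ιm≡0 : ∀ w m → 2 ℕ.* w ≡ m → ι w - ½ * ι m ≡ 0ℚ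
2w≡m⇒ιw-½ιm≡0 w m 2w≡m = begin
  ι w - ½ * ι m                  ≡⟨ cong (λ k → ι w - ½ * ι k) 2w≡m ⟨
  ι w - ½ * ι (w ℕ.+ (w ℕ.+ 0))  ≡⟨ cong (λ q → ι w - ½ * q) (trans (ι-+ w (w ℕ.+ 0)) (cong (ι w +_) (ι-+ w 0))) ⟩
  ι w - ½ * (ι w + (ι w + 0ℚ))   ≡⟨ solve 1 (λ a → a :- con ½ :* (a :+ (a :+ con 0ℚ)) := con 0ℚ) refl (ι w) ⟩
  0ℚ                             ∎
  where open ≡-Reasoning

ιw-½ιm≡0⇒2w≡m : ∀ w m → ι w - ½ * ι m ≡ 0ℚ → 2 ℕ.* w ≡ m
ιw-½ιm≡0⇒2w≡m w m ≡0 = ι-injective (begin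
  ι (w ℕ.+ (w ℕ.+ 0))                          ≡⟨ trans (ι-+ w (w ℕ.+ 0)) (cong (ι w +_) (ι-+ w 0)) ⟩
  ι w + (ι w + 0ℚ)                             ≡⟨ regroup (ι w) (ι m) ⟩
  (ι w - ½ * ι m) * (1ℚ + 1ℚ) + ι m            ≡⟨ cong (λ q → q * (1ℚ + 1ℚ) + ι m) ≡0 ⟩
  0ℚ * (1ℚ + 1ℚ) + ι m                         ≡⟨ ℚP.+-identityˡ (ι m) ⟩
  ι m                                          ∎)
  where
  open ≡-Reasoning
  regroup : ∀ a b → a + (a + 0ℚ) ≡ (a - ½ * b) * (1ℚ + 1ℚ) + b
  regroup = solve 2 (λ a b → a :+ (a :+ con 0ℚ) := (a :- con ½ :* b) :* con (1ℚ + 1ℚ) :+ b) refl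

module _ {m : ℕ} {d : Choice (suc m)} (d-choice : IsChoice d) (d-full : Full d) where

  divergence-centred : ∀ x → sum (centred (t d) x) ≡ ι (wins d x) - ½ * ι m
  divergence-centred x = begin
    sum (λ y → (1ℚ - δ x y) * (t d x y - ½))
      ≡⟨ sum-cong-≗ (λ y → trans (split (δ x y) (t d x y))
           (cong₂ (λ b e → b + - (½ * (1ℚ - e))) (sym (chosen-t d-choice d-full y)) (δ-comm x y))) ⟩
    sum (λ y → chosen y + - (½ * (1ℚ - δ y x)))
      ≡⟨ ∑-distrib-+ chosen (λ y → - (½ * (1ℚ - δ y x))) ⟩
    sum chosen + sum (λ y → - (½ * (1ℚ - δ y x)))
      ≡⟨ cong₂ _+_ (sym ι-wins) (trans (sum-neg (λ y → ½ * (1ℚ - δ y x))) (cong -_ (sum-*ˡ ½ (λ y → 1ℚ - δ y x)))) ⟩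
    ι (wins d x) + - (½ * sum (λ y → 1ℚ - δ y x))
      ≡⟨ cong (λ s → ι (wins d x) - ½ * s) off-diagonal ⟩
    ι (wins d x) - ½ * ι m ∎
    where
    open ≡-Reasoning
    open Wins d x
    split : ∀ e a → (1ℚ - e) * (a - ½) ≡ (1ℚ - e) * a + - (½ * (1ℚ - e))
    split = solve 2 (λ e a → (con 1ℚ :- e) :* (a :- con ½) := (con 1ℚ :- e) :* a :+ (:- (con ½ :* (con 1ℚ :- e)))) refl
    off-diagonal : sum (λ y → 1ℚ - δ y x) ≡ ι m
    off-diagonal = begin
      sum (λ y → 1ℚ - δ y x)                 ≡⟨ ∑-distrib-+ {suc m} (λ _ → 1ℚ) (λ y → - δ y x) ⟩
      sum {suc m} (λ _ → 1ℚ) + sum (λ y → - δ y x)   ≡⟨ cong₂ _+_ (sum-ones (suc m)) (trans (sum-neg (λ y → δ y x)) (cong -_ (sum-δ x))) ⟩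
      (1ℚ + ι m) - 1ℚ                        ≡⟨ solve 1 (λ a → (con 1ℚ :+ a) :- con 1ℚ := a) refl (ι m) ⟩
      ι m                                    ∎

  balanced⇒divergence-free : Balanced d → ∀ x → sum (centred (t d) x) ≡ 0ℚ
  balanced⇒divergence-free balanced x = trans (divergence-centred x) (2w≡m⇒ιw-½ιm≡0 (wins d x) m (balanced x))

  divergence-free⇒balanced : (∀ x → sum (centred (t d) x) ≡ 0ℚ) → Balanced d
  divergence-free⇒balanced div≡0 x = ιw-½ιm≡0⇒2w≡m (wins d x) m (trans (sym (divergence-centred x)) (div≡0 x))

module Unbalanced {k : ℕ} (D : Choice (suc (suc (suc k))) → Set)
                  (D-choice : ∀ d → D d → IsChoice d) (D-sym : Symmetric D)
                  {d : Choice (suc (suc (suc k)))} (Dd : D d) (d-full : Full d) (d-unbalanced : ¬ Balanced d) where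

  open Cone D D-choice D-sym
  open Triangles D D-choice D-sym Dd d-full

  private
    N : ℕ
    N = suc (suc (suc k))
    u : Flow N
    u = centred (t d)
    u-skew : Skew u
    u-skew = centred-skew {T = t d} (t-complementary (D-choice d Dd))
    u-feasible : Feasible u
    u-feasible = feasible-centred (Hull.inPrCl-vertex D Dd)
    div : Fin N → ℚ
    div x = sum (u x)

  divergence-after-transposition : ∀ p q x → p ≢ q →
    div x - sum ((transpose p q · u) x) ≡ (div p - div q) * (δ x p - δ x q)
  divergence-after-transposition p q x p≢q = trans (cong (λ s → div x - s) (sym (sum-permute (u σ⁻¹x) (Perm.flip σ)))) (by-cases (x ≟ p) (x ≟ q))
    where
    σ = transpose p q
    σ⁻¹x = σ ⟨$⟩ˡ x
    Δ = div p - div q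
    by-cases : Dec (x ≡ p) → Dec (x ≡ q) → div x - div σ⁻¹x ≡ Δ * (δ x p - δ x q)
    by-cases (yes refl) _ = trans (cong (λ z → div x - div z) (transpose-sends-j q x))
      (sym (trans (cong₂ (λ a b → Δ * (a - b)) (δ-diag x) (δ-≢ p≢q)) (ℚP.*-identityʳ Δ)))
    by-cases (no x≢p) (yes refl) = trans (cong (λ z → div x - div z) (transpose-sends-i x p))
      (sym (trans (cong₂ (λ a b → Δ * (a - b)) (δ-≢ (p≢q ∘ sym)) (δ-diag x)) (negated (div p) (div x))))
      where
      negated : ∀ a b → (a - b) * (0ℚ - 1ℚ) ≡ b - a
      negated = solve 2 (λ a b → (a :- b) :* (con 0ℚ :- con 1ℚ) := b :- a) refl
    by-cases (no x≢p) (no x≢q) = trans (cong (λ z → div x - div z) (transpose-fixes x≢q x≢p))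
      (trans (ℚP.+-inverseʳ (div x)) (sym (trans (cong₂ (λ a b → Δ * (a - b)) (δ-≢ x≢p) (δ-≢ x≢q)) (ℚP.*-zeroʳ Δ))))

  transposition-defect : Fin N → Fin N → Flow N
  transposition-defect p q = (div p - div q) ⊛ arc p q ⊕ ⊖ (u ⊕ ⊖ (transpose p q · u))

  transposition-defect-circulation : ∀ p q → p ≢ q → Circulation (transposition-defect p q)
  transposition-defect-circulation p q p≢q = skew , rows
    where
    σ = transpose p q
    Δ = div p - div q
    skew : Skew (transposition-defect p q)
    skew x y = trans (cong₂ (λ a c → Δ * a + - (u y x + - c)) (arc-skew p q x y) (u-skew (σ ⟨$⟩ˡ x) (σ ⟨$⟩ˡ y)))
                     (trans (cong (λ b → Δ * - arc p q x y + - (b + - - u (σ ⟨$⟩ˡ x) (σ ⟨$⟩ˡ y))) (u-skew x y))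
                            (negate Δ (arc p q x y) (u x y) (u (σ ⟨$⟩ˡ x) (σ ⟨$⟩ˡ y))))
      where
      negate : ∀ Δ a b c → Δ * - a + - (- b + - - c) ≡ - (Δ * a + - (b + - c))
      negate = solve 4 (λ Δ a b c → Δ :* (:- a) :+ (:- ((:- b) :+ (:- (:- c)))) := :- (Δ :* a :+ (:- (b :+ (:- c))))) refl
    rows : ∀ x → sum (transposition-defect p q x) ≡ 0ℚ
    rows x = begin
      sum (λ y → Δ * arc p q x y + - (u x y + - (σ · u) x y))
        ≡⟨ ∑-distrib-+ (λ y → Δ * arc p q x y) (λ y → - (u x y + - (σ · u) x y)) ⟩
      sum (λ y → Δ * arc p q x y) + sum (λ y → - (u x y + - (σ · u) x y))
        ≡⟨ cong₂ _+_ (sum-*ˡ Δ (arc p q x)) (sum-neg (λ y → u x y + - (σ · u) x y)) ⟩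
      Δ * sum (arc p q x) + - sum (λ y → u x y + - (σ · u) x y)
        ≡⟨ cong₂ (λ a c → Δ * a + - c) (arc-divergence p q x)
                 (trans (∑-distrib-+ (u x) (λ y → - (σ · u) x y)) (cong (div x +_) (sum-neg ((σ · u) x)))) ⟩
      Δ * (δ x p - δ x q) + - (div x - sum ((σ · u) x))
        ≡⟨ cong (λ c → Δ * (δ x p - δ x q) + - c) (divergence-after-transposition p q x p≢q) ⟩
      Δ * (δ x p - δ x q) + - (Δ * (δ x p - δ x q))
        ≡⟨ ℚP.+-inverseʳ (Δ * (δ x p - δ x q)) ⟩
      0ℚ ∎
      where open ≡-Reasoning

  feasible-arc-of-unequal-divergence : ∀ p q → div p ≢ div q → Feasible (arc p q)
  feasible-arc-of-unequal-divergence p q div-p≢div-q = feasible-⊛⁻¹ Δ≢0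
    (feasible-≐ (feasible-⊕ (feasible-circulation (transposition-defect-circulation p q (div-p≢div-q ∘ cong div)))
                            (feasible-⊕ u-feasible (feasible-neg (feasible-act (transpose p q) u-feasible))))
                (λ x y _ → solve 2 (λ a c → a :+ (:- c) :+ c := a) refl (Δ * arc p q x y) ((u ⊕ ⊖ (transpose p q · u)) x y)))
    where
    Δ = div p - div q
    Δ≢0 : Δ ≢ 0ℚ
    Δ≢0 Δ≡0 = div-p≢div-q (trans (solve 2 (λ a b → a := (a :- b) :+ b) refl (div p) (div q))
                                 (trans (cong (_+ div q) Δ≡0) (ℚP.+-identityˡ (div q))))

  nonzero-divergence : ∃ λ x → div x ≢ 0ℚ
  nonzero-divergence = FinP.¬∀⟶∃¬ N (λ x → div x ≡ 0ℚ) (λ x → div x ℚP.≟ 0ℚ)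
                         (d-unbalanced ∘ divergence-free⇒balanced (D-choice d Dd) d-full)

  -- The divergences of u sum to zero (ΣΣ-skew) and do not all vanish (d is unbalanced).
  unequal-divergences : ∃ λ p → ∃ λ q → div p ≢ div q
  unequal-divergences = differ nonzero-divergence
    where
    constant-vanishes : ∀ x → (∀ q → div q ≡ div x) → div x ≡ 0ℚ
    constant-vanishes x div≡ = constant-sum-vanishes (suc (suc k)) (div x)
      (trans (sum-cong-≗ (λ q → sym (div≡ q))) (ΣΣ-skew u-skew))
    differ : (∃ λ x → div x ≢ 0ℚ) → ∃ λ p → ∃ λ q → div p ≢ div q
    differ (x , div-x≢0) = let q , div-q≢div-x = FinP.¬∀⟶∃¬ N (λ q → div q ≡ div x) (λ q → div q ℚP.≟ div x)
                                                    (div-x≢0 ∘ constant-vanishes x)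
                           in q , x , div-q≢div-x

  feasible-arc : ∀ a b → Feasible (arc a b)
  feasible-arc a b with a ≟ b
  ... | yes refl = feasible-≐ 𝟎-feasible (λ x y _ → sym (ℚP.+-inverseʳ (δ x a * δ y a)))
  ... | no a≢b = transport unequal-divergences
    where
    transport : (∃ λ p → ∃ λ q → div p ≢ div q) → Feasible (arc a b)
    transport (p , q , div-p≢div-q) with permutation-sending₂ {a = p} {q} (div-p≢div-q ∘ cong div) a≢b
    ... | π , πp≡a , πq≡b = feasible-≐ (feasible-act π (feasible-arc-of-unequal-divergence p q div-p≢div-q))
                              (λ x y x≢y → trans (arc-act π p q x y x≢y) (cong₂ (λ s r → arc s r x y) πp≡a πq≡b))

  feasible-skew-flow : ∀ {v} → Skew v → Feasible v
  feasible-skew-flow {v} v-skew =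
    feasible-≐ (feasible-⨁ 𝟎-feasible (λ a → feasible-⨁ 𝟎-feasible (λ b → feasible-⊛ (feasible-arc a b) (½ * v a b))))
               (λ x y _ → skew-decomposition v-skew x y)

-- Sign patterns and majority

module Majority {m : ℕ} (D : Choice (suc m) → Set)
                (D-choice : ∀ d → D d → IsChoice d) (D-sym : Symmetric D) where

  open Cone D D-choice D-sym

  sign-pattern⇒maj-cl : ∀ {c F} → IsChoice c → Feasible F → SignOf c F → InMajCl D c
  sign-pattern⇒maj-cl {c} {F} c-choice F-feasible@(ε , ε>0 , P) F-sign = T , P , c≈majT
    where
    T : Flow (suc m)
    T x y = ½ + ε * F x y
    ½<T : ∀ {x y} → 0ℚ ℚ.< F x y → ½ ℚ.< T x y
    ½<T F>0 = ℚP.≤-<-trans (ℚP.≤-reflexive (sym (ℚP.+-identityʳ ½))) (ℚP.+-monoʳ-< ½ (*-pos ε>0 F>0))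
    T<½ : ∀ {x y} → x ≢ y → 0ℚ ℚ.< F y x → T x y ℚ.< ½
    T<½ {x} {y} x≢y F>0 = ℚP.<-≤-trans (ℚP.+-monoʳ-< ½ εF<0) (ℚP.≤-reflexive (ℚP.+-identityʳ ½))
      where
      εF<0 : ε * F x y ℚ.< 0ℚ
      εF<0 = subst (λ q → q ℚ.< 0ℚ) (trans (ℚP.neg-distribʳ-* ε (F y x)) (cong (ε *_) (sym (feasible-skew F-feasible y x (x≢y ∘ sym)))))
                   (ℚP.neg-antimono-< (*-pos ε>0 F>0))
    c≈majT : c ≈ maj T
    c≈majT x y x≢y = by-cases (c x y) refl
      where
      by-cases : ∀ r → c x y ≡ r → c x y ≡ maj T x y
      by-cases nothing cxy = trans cxy (sym (maj-≡ T (trans (cong (λ f → ½ + ε * f) (proj₂ (F-sign x y x≢y) cxy))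
                                                        (trans (cong (½ +_) (ℚP.*-zeroʳ ε)) (ℚP.+-identityʳ ½)))))
      by-cases (just z) cxy with proj₂ (c-choice x y x≢y) z cxy
      ... | inj₂ refl = trans cxy (sym (maj-> T (½<T (proj₁ (F-sign x y x≢y) cxy))))
      ... | inj₁ refl = trans cxy (sym (maj-< T (T<½ x≢y (proj₁ (F-sign y x (x≢y ∘ sym)) (trans (sym (proj₁ (c-choice x y x≢y))) cxy)))))

module CycleFlows {n : ℕ} {c : Choice n} (c-choice : IsChoice c) where

  WeakSignOf : Flow n → Set
  WeakSignOf F = ∀ a b → a ≢ b → (c a b ≡ just b → 0ℚ ℚ.≤ F a b) × (c a b ≡ nothing → F a b ≡ 0ℚ)

  weak-𝟎 : WeakSignOf 𝟎
  weak-𝟎 a b _ = (λ _ → ℚP.≤-refl) , (λ _ → refl)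

  weak-⊕ : ∀ {F G} → WeakSignOf F → WeakSignOf G → WeakSignOf (F ⊕ G)
  weak-⊕ F-sign G-sign a b a≢b =
    (λ cab → ℚP.+-mono-≤ (proj₁ (F-sign a b a≢b) cab) (proj₁ (G-sign a b a≢b) cab)) ,
    (λ cab → trans (cong₂ _+_ (proj₂ (F-sign a b a≢b) cab) (proj₂ (G-sign a b a≢b) cab)) (ℚP.+-identityʳ 0ℚ))

  weak-⨁ : ∀ {k} {g : Fin k → Flow n} → (∀ i → WeakSignOf (g i)) → WeakSignOf (⨁ g)
  weak-⨁ {zero} g-sign = weak-𝟎
  weak-⨁ {suc k} g-sign = weak-⊕ (g-sign zero) (weak-⨁ (g-sign ∘ suc))

  weak-arc : ∀ {a′ b′} → Edge c a′ b′ → WeakSignOf (arc a′ b′)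
  weak-arc {a′} {b′} (a′≢b′ , ca′b′) a b a≢b = forward , absent
    where
    c-sym : c b′ a′ ≡ just b′
    c-sym = trans (sym (proj₁ (c-choice a′ b′ a′≢b′))) ca′b′
    forward : c a b ≡ just b → 0ℚ ℚ.≤ arc a′ b′ a b
    forward cab = ℚP.≤-trans (*-nonneg (δ-nonneg a a′) (δ-nonneg b b′))
      (ℚP.≤-reflexive (sym (trans (cong (λ r → δ a a′ * δ b b′ - r) (δδ-≢ reversed)) (ℚP.+-identityʳ _))))
      where
      reversed : ¬ (a ≡ b′ × b ≡ a′)
      reversed (refl , refl) = a′≢b′ (just-injective (trans (sym cab) c-sym))
    absent : c a b ≡ nothing → arc a′ b′ a b ≡ 0ℚ
    absent cab = cong₂ _-_ (δδ-≢ {a = a} {a′} {b} {b′} (λ { (refl , refl) → nothing≢just (trans (sym cab) ca′b′) }))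
                           (δδ-≢ {a = a} {b′} {b} {a′} (λ { (refl , refl) → nothing≢just (trans (sym cab) c-sym) }))
      where
      nothing≢just : ∀ {z : Fin n} → nothing ≢ just z
      nothing≢just ()

  walk-flow : ∀ {a b} → Star (Edge c) a b → Flow n
  walk-flow Star.ε = 𝟎
  walk-flow (_◅_ {i = a} {j = a′} _ walk) = arc a a′ ⊕ walk-flow walk

  walk-skew : ∀ {a b} (walk : Star (Edge c) a b) → Skew (walk-flow walk)
  walk-skew Star.ε x y = refl
  walk-skew (_◅_ {i = a} {j = a′} _ walk) x y =
    trans (cong₂ _+_ (arc-skew a a′ x y) (walk-skew walk x y)) (sym (ℚP.neg-distrib-+ (arc a a′ x y) _))

  walk-divergence : ∀ {a b} (walk : Star (Edge c) a b) x → sum (walk-flow walk x) ≡ δ x a - δ x b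
  walk-divergence {a} Star.ε x = trans (sum-zero n) (sym (ℚP.+-inverseʳ (δ x a)))
  walk-divergence {a} {b} (_◅_ {j = a′} _ walk) x =
    trans (∑-distrib-+ (arc a a′ x) (walk-flow walk x))
          (trans (cong₂ _+_ (arc-divergence a a′ x) (walk-divergence walk x)) (telescope (δ x a) (δ x a′) (δ x b)))
    where
    telescope : ∀ p q r → (p - q) + (q - r) ≡ p - r
    telescope = solve 3 (λ p q r → (p :- q) :+ (q :- r) := p :- r) refl

  walk-weak : ∀ {a b} (walk : Star (Edge c) a b) → WeakSignOf (walk-flow walk)
  walk-weak Star.ε = weak-𝟎
  walk-weak (edge ◅ walk) = weak-⊕ (weak-arc edge) (walk-weak walk)

  module _ (c-pb : PseudoBalanced c) where

    cycle-flow : ∀ a b → Dec (Edge c a b) → Flow n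
    cycle-flow a b (yes edge) = arc a b ⊕ walk-flow (c-pb a b edge)
    cycle-flow a b (no _) = 𝟎

    cycle-circulation : ∀ a b edge? → Circulation (cycle-flow a b edge?)
    cycle-circulation a b (no _) = circulation-𝟎
    cycle-circulation a b (yes edge) = skew , rows
      where
      back = c-pb a b edge
      skew : Skew (arc a b ⊕ walk-flow back)
      skew x y = trans (cong₂ _+_ (arc-skew a b x y) (walk-skew back x y)) (sym (ℚP.neg-distrib-+ (arc a b x y) _))
      rows : ∀ x → sum (λ y → arc a b x y + walk-flow back x y) ≡ 0ℚ
      rows x = trans (∑-distrib-+ (arc a b x) (walk-flow back x))
        (trans (cong₂ _+_ (arc-divergence a b x) (walk-divergence back x)) (round-trip (δ x a) (δ x b)))
        where
        round-trip : ∀ p q → (p - q) + (q - p) ≡ 0ℚ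
        round-trip = solve 2 (λ p q → (p :- q) :+ (q :- p) := con 0ℚ) refl

    cycle-weak : ∀ a b edge? → WeakSignOf (cycle-flow a b edge?)
    cycle-weak a b (no _) = weak-𝟎
    cycle-weak a b (yes edge) = weak-⊕ (weak-arc edge) (walk-weak (c-pb a b edge))

    cycle-at-its-edge : ∀ a b → a ≢ b → c a b ≡ just b → ∀ edge? → 1ℚ ℚ.≤ cycle-flow a b edge? a b
    cycle-at-its-edge a b a≢b cab (no ¬edge) = ⊥-elim (¬edge (a≢b , cab))
    cycle-at-its-edge a b a≢b cab (yes edge) =
      ℚP.≤-trans (ℚP.≤-reflexive (sym (trans (cong (_+ 0ℚ) arc-ab) (ℚP.+-identityʳ 1ℚ))))
                 (ℚP.+-monoʳ-≤ (arc a b a b) (proj₁ (walk-weak (c-pb a b edge) a b a≢b) cab))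
      where
      arc-ab : arc a b a b ≡ 1ℚ
      arc-ab = cong₂ _-_ (cong₂ _*_ (δ-diag a) (δ-diag b)) (δδ-≢ {a = a} {b} {b} {a} (λ (a≡b , _) → a≢b a≡b))

    cycles : Fin n → Fin n → Flow n
    cycles a b = cycle-flow a b (edge? c a b)

    cycles-weak : ∀ a b → WeakSignOf (cycles a b)
    cycles-weak a b = cycle-weak a b (edge? c a b)

    pseudo-balanced-flow : Flow n
    pseudo-balanced-flow = ⨁ λ a → ⨁ (cycles a)

    pseudo-balanced-circulation : Circulation pseudo-balanced-flow
    pseudo-balanced-circulation = circulation-⨁ (λ a → circulation-⨁ (λ b → cycle-circulation a b (edge? c a b)))

    pseudo-balanced-sign : SignOf c pseudo-balanced-flow
    pseudo-balanced-sign a b a≢b = strict , proj₂ (weak-⨁ (λ a′ → weak-⨁ (cycles-weak a′)) a b a≢b)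
      where
      strict : c a b ≡ just b → 0ℚ ℚ.< pseudo-balanced-flow a b
      strict cab = ℚP.<-≤-trans (ℚP.positive⁻¹ 1ℚ) (begin
        1ℚ                        ≤⟨ cycle-at-its-edge a b a≢b cab (edge? c a b) ⟩
        cycles a b a b            ≤⟨ term≤sum (λ b′ → cycles a b′ a b) (λ b′ → proj₁ (cycles-weak a b′ a b a≢b) cab) b ⟩
        ⨁ (cycles a) a b          ≤⟨ term≤sum (λ a′ → ⨁ (cycles a′) a b) (λ a′ → proj₁ (weak-⨁ (cycles-weak a′) a b a≢b) cab) a ⟩
        pseudo-balanced-flow a b  ∎)
        where open ℚP.≤-Reasoning

-- Necessity: the cut argument

insert : (Fin n → Bool) → Fin n → Fin n → Bool
insert S v z = if does (z ≟ v) then true else S z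

unreached : ∀ {k} → (Fin k → Bool) → ℕ
unreached {zero} S = 0
unreached {suc k} S = (if S zero then 0 else 1) ℕ.+ unreached (S ∘ suc)

unreached-≤ : ∀ {k} (S : Fin k → Bool) → unreached S ≤ k
unreached-≤ {zero} S = z≤n
unreached-≤ {suc k} S with S zero
... | true = ℕP.m≤n⇒m≤1+n (unreached-≤ (S ∘ suc))
... | false = s≤s (unreached-≤ (S ∘ suc))

unreached-insert : ∀ {k} (S : Fin k → Bool) v → S v ≡ false → unreached (insert S v) ℕ.< unreached S
unreached-insert {suc k} S zero Sv≡false rewrite Sv≡false = ℕP.≤-refl
unreached-insert {suc k} S (suc v) Sv≡false = ℕP.+-monoʳ-< (if S zero then 0 else 1) (unreached-insert (S ∘ suc) v Sv≡false)

module Reachability {R : Fin n → Fin n → Set} (R? : ∀ a b → Dec (R a b)) (y : Fin n) where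

  Reached : (Fin n → Bool) → Set
  Reached S = S y ≡ true × (∀ z → S z ≡ true → Star R y z)

  Closed : (Fin n → Bool) → Set
  Closed S = ∀ a b → S a ≡ true → S b ≡ false → ¬ R a b

  private
    crossing? : (S : Fin n → Bool) → Dec (∃ λ a → ∃ λ b → S a ≡ true × S b ≡ false × R a b)
    crossing? S = FinP.any? (λ a → FinP.any? (λ b → (S a BoolP.≟ true) ×-dec (S b BoolP.≟ false) ×-dec R? a b))

    reached-insert : ∀ (S : Fin n → Bool) a b → Reached S → S a ≡ true → R a b → Reached (insert S b)
    reached-insert S a b (Sy , paths) Sa Rab = Sy′ , paths′
      where
      Sy′ : insert S b y ≡ true
      Sy′ with y ≟ b
      ... | yes _ = refl
      ... | no _ = Sy
      paths′ : ∀ z → insert S b z ≡ true → Star R y z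
      paths′ z Sz with z ≟ b
      ... | yes refl = paths a Sa ◅◅ (Rab ◅ Star.ε)
      ... | no _ = paths z Sz

    grow : ∀ fuel (S : Fin n → Bool) → Reached S → unreached S ≤ fuel → ∃ λ S′ → Reached S′ × Closed S′
    grow fuel S reached bound with crossing? S
    ... | no none = S , reached , λ a b Sa Sb Rab → none (a , b , Sa , Sb , Rab)
    grow zero S reached bound | yes (a , b , Sa , Sb , Rab) =
      ⊥-elim (ℕP.n≮0 (ℕP.<-≤-trans (unreached-insert S b Sb) bound))
    grow (suc fuel) S reached bound | yes (a , b , Sa , Sb , Rab) =
      grow fuel (insert S b) (reached-insert S a b reached Sa Rab) (ℕP.≤-pred (ℕP.<-≤-trans (unreached-insert S b Sb) bound))

  closed-reachable-set : ∃ λ S → Reached S × Closed S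
  closed-reachable-set = grow n start (start-y , start-paths) (unreached-≤ start)
    where
    start : Fin n → Bool
    start z = does (z ≟ y)
    start-y : start y ≡ true
    start-y with y ≟ y
    ... | yes _ = refl
    ... | no y≢y = ⊥-elim (y≢y refl)
    start-paths : ∀ z → start z ≡ true → Star R y z
    start-paths z Sz with z ≟ y
    ... | yes refl = Star.ε
    start-paths z () | no _

𝟙 : Bool → ℚ
𝟙 b = if b then 1ℚ else 0ℚ

cut-flow-vanishes : {W : Flow n} → Circulation W → (S : Fin n → Bool) →
                    ΣΣ (λ a b → 𝟙 (S a) * (1ℚ - 𝟙 (S b)) * W b a) ≡ 0ℚ
cut-flow-vanishes {n} {W} W-circ@(W-skew , W-rows) S = begin
  ΣΣ (λ a b → 𝟙 (S a) * (1ℚ - 𝟙 (S b)) * W b a)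
    ≡⟨ ΣΣ-cong (λ a b → trans (cong (𝟙 (S a) * (1ℚ - 𝟙 (S b)) *_) (W-skew a b)) (split (𝟙 (S a)) (𝟙 (S b)) (W a b))) ⟩
  ΣΣ (λ a b → - 1ℚ * (W a b * 𝟙 (S a)) + inside a b)
    ≡⟨ ΣΣ-+ (λ a b → - 1ℚ * (W a b * 𝟙 (S a))) inside ⟩
  ΣΣ (λ a b → - 1ℚ * (W a b * 𝟙 (S a))) + ΣΣ inside
    ≡⟨ cong₂ _+_ (trans (ΣΣ-*ˡ (- 1ℚ) (λ a b → W a b * 𝟙 (S a))) (cong (- 1ℚ *_) (ΣΣ-row-weighted W-rows (𝟙 ∘ S))))
                 (ΣΣ-skew inside-skew) ⟩
  - 1ℚ * 0ℚ + 0ℚ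
    ≡⟨⟩
  0ℚ ∎
  where
  open ≡-Reasoning
  inside : Flow n
  inside a b = W a b * (𝟙 (S a) * 𝟙 (S b))
  inside-skew : Skew inside
  inside-skew a b = trans (cong₂ _*_ (W-skew a b) (ℚP.*-comm (𝟙 (S b)) (𝟙 (S a)))) (sym (ℚP.neg-distribˡ-* (W a b) _))
  split : ∀ p q w → p * (1ℚ - q) * - w ≡ - 1ℚ * (w * p) + w * (p * q)
  split = solve 3 (λ p q w → p :* (con 1ℚ :- q) :* (:- w) := (:- con 1ℚ) :* (w :* p) :+ w :* (p :* q)) refl

-- No edge of c leaves the set S reachable from y, so every entry of W from outside S into S is
-- nonnegative; as no net flow crosses the cut, the positive entry W x y cannot enter S from outside.
circulation-pseudo-balanced : {c : Choice n} {W : Flow n} → Circulation W →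
  (∀ a b → a ≢ b → (c a b ≡ just b → 0ℚ ℚ.< W a b) × (0ℚ ℚ.< W a b → c a b ≡ just b)) → PseudoBalanced c
circulation-pseudo-balanced {n} {c} {W} W-circ@(W-skew , _) edges⇔positive x y edge@(x≢y , cxy)
  with Reachability.closed-reachable-set (edge? c) y
... | S , (Sy , paths) , closed = by-cases (S x) refl
  where
  h : Fin n → Fin n → ℚ
  h a b = 𝟙 (S a) * (1ℚ - 𝟙 (S b)) * W b a
  h≥0 : ∀ a b → 0ℚ ℚ.≤ h a b
  h≥0 a b = by-cases′ (S a) (S b) refl refl
    where
    by-cases′ : ∀ sa sb → S a ≡ sa → S b ≡ sb → 0ℚ ℚ.≤ h a b
    by-cases′ false _ Sa _ rewrite Sa = ℚP.≤-reflexive (sym (trans (cong (_* W b a) (ℚP.*-zeroˡ (1ℚ - 𝟙 (S b)))) (ℚP.*-zeroˡ (W b a))))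
    by-cases′ true true Sa Sb rewrite Sa | Sb = ℚP.≤-reflexive (sym (ℚP.*-zeroˡ (W b a)))
    by-cases′ true false Sa Sb rewrite Sa | Sb = ℚP.≤-trans (ℚP.≮⇒≥ not-negative) (ℚP.≤-reflexive (sym (ℚP.*-identityˡ (W b a))))
      where
      a≢b : a ≢ b
      a≢b refl = true≢false (trans (sym Sa) Sb)
        where
        true≢false : true ≢ false
        true≢false ()
      not-negative : ¬ (W b a ℚ.< 0ℚ)
      not-negative Wba<0 = closed a b Sa Sb (a≢b , proj₂ (edges⇔positive a b a≢b) Wab>0)
        where
        Wab>0 : 0ℚ ℚ.< W a b
        Wab>0 = ℚP.<-≤-trans (ℚP.neg-antimono-< Wba<0) (ℚP.≤-reflexive (trans (cong -_ (W-skew a b)) (⁻¹-involutive (W a b))))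
  by-cases : ∀ sx → S x ≡ sx → Star (Edge c) y x
  by-cases true Sx = paths x Sx
  by-cases false Sx = ⊥-elim (ℚP.<-irrefl (sym (cut-flow-vanishes W-circ S)) (ΣΣ-positive h h≥0 y x hyx>0))
    where
    hyx>0 : 0ℚ ℚ.< h y x
    hyx>0 rewrite Sy | Sx = ℚP.<-≤-trans (proj₁ (edges⇔positive x y x≢y) cxy) (ℚP.≤-reflexive (sym (ℚP.*-identityˡ (W x y))))

module Necessity {m : ℕ} (D : Choice (suc m) → Set)
                 (D-choice : ∀ d → D d → IsChoice d) (D-full : ∀ d → D d → Full d) where

  open Hull D

  balanced? : (d : Choice (suc m)) → Dec (Balanced d)
  balanced? d = FinP.all? (λ x → 2 ℕ.* wins d x ℕ.≟ m)

  unbalanced-or-all-balanced : ∀ ws → Admissible ws → (∃ λ d → D d × ¬ Balanced d) ⊎ (∀ w → w ∈ ws → Balanced (proj₂ w))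
  unbalanced-or-all-balanced [] adm = inj₂ (λ _ ())
  unbalanced-or-all-balanced (w ∷ ws) adm = by-cases (balanced? (proj₂ w)) (unbalanced-or-all-balanced ws (λ w′ → adm w′ ∘ there))
    where
    by-cases : Dec (Balanced (proj₂ w)) → (∃ λ d → D d × ¬ Balanced d) ⊎ (∀ w′ → w′ ∈ ws → Balanced (proj₂ w′)) →
               (∃ λ d → D d × ¬ Balanced d) ⊎ (∀ w′ → w′ ∈ w ∷ ws → Balanced (proj₂ w′))
    by-cases (no unbalanced) _ = inj₁ (proj₂ w , proj₂ (adm w (here refl)) , unbalanced)
    by-cases (yes _) (inj₁ found) = inj₁ found
    by-cases (yes balanced) (inj₂ rest) = inj₂ λ { _ (here refl) → balanced ; w′ (there w′∈) → rest w′ w′∈ }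

  centred-circulation : ∀ {T} (P : InPrCl D T) → (∀ w → w ∈ proj₁ P → Balanced (proj₂ w)) → Circulation (centred T)
  centred-circulation {T} P@(ws , adm , unit , T≡) all-balanced = centred-skew {T = T} (inPrCl-complementary D-choice P) , rows
    where
    open ≡-Reasoning
    pointwise : ∀ a b → centred T a b ≡ average ws (λ d → centred (t d) a b)
    pointwise a b = trans (by-cases (a ≟ b)) (sym (average-centred ws (1ℚ - δ a b) (λ d → t d a b)))
      where
      by-cases : Dec (a ≡ b) → centred T a b ≡ (1ℚ - δ a b) * (average ws (λ d → t d a b) - ½ * mass ws)
      by-cases (yes refl) = trans (centred-diagonal T a) (sym (trans (cong (λ e → (1ℚ - e) * X) (δ-diag a)) (ℚP.*-zeroˡ X)))
        where X = average ws (λ d → t d a a) - ½ * mass ws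
      by-cases (no a≢b) = cong ((1ℚ - δ a b) *_) (cong₂ _-_ (T≡ a b a≢b) (sym (trans (cong (½ *_) unit) (ℚP.*-identityʳ ½))))
    rows : ∀ a → sum (centred T a) ≡ 0ℚ
    rows a = begin
      sum (centred T a)                                     ≡⟨ sum-cong-≗ (pointwise a) ⟩
      sum (λ b → average ws (λ d → centred (t d) a b))      ≡⟨ average-sum ws (λ d → centred (t d) a) ⟩
      average ws (λ d → sum (centred (t d) a))              ≡⟨ average-vanishes ws _ (λ w w∈ →
           balanced⇒divergence-free (D-choice _ (proj₂ (adm w w∈))) (D-full _ (proj₂ (adm w w∈))) (all-balanced w w∈) a) ⟩
      0ℚ                                                    ∎

  maj-cl⇒unbalanced⊎pseudo-balanced : ∀ {c} → InMajCl D c → (∃ λ d → D d × ¬ Balanced d) ⊎ PseudoBalanced c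
  maj-cl⇒unbalanced⊎pseudo-balanced {c} (T , P@(ws , adm , _ , _) , c≈majT) with unbalanced-or-all-balanced ws adm
  ... | inj₁ found = inj₁ found
  ... | inj₂ all-balanced = inj₂ (circulation-pseudo-balanced (centred-circulation P all-balanced) edges⇔positive)
    where
    edges⇔positive : ∀ a b → a ≢ b → (c a b ≡ just b → 0ℚ ℚ.< centred T a b) × (0ℚ ℚ.< centred T a b → c a b ≡ just b)
    edges⇔positive a b a≢b =
      (λ cab → subst (0ℚ ℚ.<_) (sym (centred-≐ T a b a≢b)) (½<⇒0<-½ (maj-just⇒> T a≢b (trans (sym (c≈majT a b a≢b)) cab)))) ,
      (λ W>0 → trans (c≈majT a b a≢b) (maj-> T (0<-½⇒½< (subst (0ℚ ℚ.<_) (centred-≐ T a b a≢b) W>0))))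

mainTheorem9 : (n : ℕ) → 3 ≤ n →
    (D : Choice n → Set) →
    ((d e : Choice n) → d ≈ e → D d → D e) →
    ((d : Choice n) → D d → IsChoice d × Full d) →
    (∃ λ d → D d) →
    Symmetric D →
    (c : Choice n) → IsChoice c →
    (InMajCl D c ⇔ ((∃ λ d → D d × ¬ Balanced d) ⊎ PseudoBalanced c))
mainTheorem9 (suc (suc (suc k))) (s≤s (s≤s (s≤s z≤n))) D _ D-choice-full (d , Dd) D-sym c c-choice =
  mk⇔ (Necessity.maj-cl⇒unbalanced⊎pseudo-balanced D D-choice D-full) sufficiency
  where
  D-choice = λ d → proj₁ ∘ D-choice-full d
  D-full = λ d → proj₂ ∘ D-choice-full d
  open Majority D D-choice D-sym
  open CycleFlows c-choice
  sufficiency : (∃ λ d → D d × ¬ Balanced d) ⊎ PseudoBalanced c → InMajCl D c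
  sufficiency (inj₁ (d′ , Dd′ , unbalanced)) =
    sign-pattern⇒maj-cl c-choice (Unbalanced.feasible-skew-flow D D-choice D-sym Dd′ (D-full d′ Dd′) unbalanced
                          (centred-skew {T = t c} (t-complementary c-choice)))
              centred-sign
  sufficiency (inj₂ c-pb) =
    sign-pattern⇒maj-cl c-choice (Triangles.feasible-circulation D D-choice D-sym Dd (D-full d Dd) (pseudo-balanced-circulation c-pb))
              (pseudo-balanced-sign c-pb)
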